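{- Let $R$ be a unital commutative ring and $T=(V,E)$ a tree with $V=[n]$, each edge $\{i,j\}$ carrying $a_{ij}=a_{ji},m_{ij},m_{ji}\in R$, such that all $a_{ij}$, all $m_{ij}m_{ji}-1$, and $\det(D_T)$ are invertible in $R$. Define $\boldsymbol\tau_{\rm in},\boldsymbol\tau_{\rm out}\in R^V$ by $$\boldsymbol\tau_{\rm in}(i)=1-\sum_{j\sim i}\frac{m_{ji}(m_{ij}-1)}{m_{ij}m_{ji}-1},\qquad \boldsymbol\tau_{\rm out}(i)=1-\sum_{j\sim i}\frac{m_{ij}(m_{ji}-1)}{m_{ij}m_{ji}-1},$$ and the Laplacian $L_T\in R^{V\times V}$ by $(L_T)_{ij}=\frac{ -m_{ij}}{a_{ij}(m_{ij}m_{ji}-1)}$ if $i\sim j$, $(L_T)_{ii}=\sum_{k\sim i}\frac{m_{ki}}{a_{ik}(m_{ik}m_{ki}-1)}$, and $0$ otherwise. Let $\alpha_T=\sum_{e\in E}\frac{a_e(m_e-1)(m'_e-1)}{m_em'_e-1}$ and let $C_T\in R^{V\times V}$ be as defined in the context. Then $$D_T^{ -1}=\alpha_T^{ -1}\,\boldsymbol\tau_{\rm out}\boldsymbol\tau_{\rm in}^T-L_T+C_T\operatorname{diag}(\boldsymbol\tau_{\rm in}).$$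
   Context: $i\sim j$ means $i\ne j$ are adjacent in $T$. For an edge $e=\{i,j\}$, $i<j$: $a_e=a_{ij}$, $m_e=m_{ij}$, $m'_e=m_{ji}$. $D_T$ is the matrix with $(i,j)$ entry $\sum_{l=0}^{k-1}a_{i_li_{l+1}}(m_{i_li_{l+1}}-1)\prod_{u=0}^{l-1}m_{i_ui_{u+1}}$, where $i=i_0,\dots,i_k=j$ is the path from $i$ to $j$ (diagonal $0$). For adjacent $i\sim j$, $T_{i\to j}$ is the subtree induced on $i$, $j$ and all nodes $v$ whose path from $i$ passes through $j$. Set $\beta_i=\frac1{\alpha_T}\sum_{j\sim i}\frac1{a_{ij}}\sum_{e\in E(T_{i\to j})}\frac{a_e(m_e-1)(m'_e-1)}{m_em'_e-1}$. Then $(C_T)_{ii}=\beta_i$, and for $j\neq i$, $(C_T)_{ij}=\beta_i-\frac1{a_{ik}}$ where $k$ is the neighbour of $i$ with $j\in T_{i\to k}$. ($\alpha_T$ is invertible under the hypotheses.) -}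

module Defs where

open import Level using (_⊔_)
open import Data.Nat as ℕ using (ℕ; zero; suc; _≤_)
open import Data.Bool using (Bool; true; false; T; if_then_else_; _∧_; _∨_)
open import Data.Fin as Fin using (Fin; zero; suc; toℕ; punchIn)
open import Data.List using (List; []; _∷_)
open import Data.Bool.ListAction using (any)
open import Data.List.Relation.Unary.Unique.Propositional using (Unique)
open import Data.Product using (Σ; _×_; proj₁)
open import Data.Unit using (tt)
open import Relation.Nullary using (yes; no)
open import Relation.Nullary.Decidable using (⌊_⌋)
open import Relation.Binary.PropositionalEquality using (_≡_)
open import Algebra.Bundles using (CommutativeRing)
import Algebra.Properties.Monoid.Sum as MonoidSum

module _ {n : ℕ} (adj : Fin n → Fin n → Bool) where

  Adj : Fin n → Fin n → Set
  Adj i j = T (adj i j)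

  data IsWalk : Fin n → Fin n → List (Fin n) → Set where
    here : ∀ {i} → IsWalk i i (i ∷ [])
    step : ∀ {i j k ps} → Adj i j → IsWalk j k ps → IsWalk i k (i ∷ ps)

  IsPath : Fin n → Fin n → List (Fin n) → Set
  IsPath i j ps = IsWalk i j ps × Unique ps

  record IsTree : Set where
    field
      nonempty    : 1 ≤ n
      symmetric   : ∀ i j → adj i j ≡ adj j i
      irreflexive : ∀ i → adj i i ≡ false
      connected   : ∀ i j → Σ (List (Fin n)) (IsPath i j)
      pathUnique  : ∀ i j ps qs → IsPath i j ps → IsPath i j qs → ps ≡ qs

  path : IsTree → Fin n → Fin n → List (Fin n)
  path t i j = proj₁ (IsTree.connected t i j)

module _ {c ℓ} (R : CommutativeRing c ℓ) where
  open CommutativeRing R hiding (zero)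
  open MonoidSum +-monoid using (sum)

  Invertible : Carrier → Set (c ⊔ ℓ)
  Invertible x = Σ Carrier (λ y → x * y ≈ 1#)

  Matrix : ℕ → Set c
  Matrix n = Fin n → Fin n → Carrier

  ∑ : ∀ {n} → (Fin n → Carrier) → Carrier
  ∑ f = sum f

  when : (b : Bool) → (T b → Carrier) → Carrier
  when true  f = f tt
  when false f = 0#

  _*M_ : ∀ {n} → Matrix n → Matrix n → Matrix n
  (A *M B) i j = ∑ (λ k → A i k * B k j)

  idM : ∀ {n} → Matrix n
  idM i j = if ⌊ i Fin.≟ j ⌋ then 1# else 0#

  sgn : ℕ → Carrier
  sgn ℕ.zero    = 1#
  sgn (suc k) = - sgn k

  det : ∀ {n} → Matrix n → Carrier
  det {ℕ.zero}  M = 1#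
  det {suc n} M = ∑ (λ j → sgn (toℕ j) * (M Fin.zero j * det (λ a b → M (suc a) (punchIn j b))))

module TreeObjects {c ℓ} (R : CommutativeRing c ℓ) {n : ℕ}
  (adj : Fin n → Fin n → Bool) (t : IsTree adj)
  (a m : Matrix R n)
  (aInv : ∀ i j → Adj adj i j → Invertible R (a i j))
  (qInv : ∀ i j → Adj adj i j →
            Invertible R (CommutativeRing._-_ R (CommutativeRing._*_ R (m i j) (m j i))
                                                (CommutativeRing.1# R)))
  where
  open CommutativeRing R hiding (zero)

  ∑′ = ∑ R
  when′ = when R

  ainv : ∀ i j → Adj adj i j → Carrier
  ainv i j p = proj₁ (aInv i j p)

  qinv : ∀ i j → Adj adj i j → Carrier
  qinv i j p = proj₁ (qInv i j p)

  -- ∑_{l=0}^{k-1} a_{i_l i_{l+1}} (m_{i_l i_{l+1}} - 1) ∏_{u<l} m_{i_u i_{u+1}}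
  pathSum : List (Fin n) → Carrier
  pathSum []           = 0#
  pathSum (x ∷ [])     = 0#
  pathSum (x ∷ y ∷ ps) = a x y * (m x y - 1#) + m x y * pathSum (y ∷ ps)

  D : Matrix R n
  D i j = pathSum (path adj t i j)

  τin : Fin n → Carrier
  τin i = 1# - ∑′ (λ j → when′ (adj i j) (λ p → m j i * (m i j - 1#) * qinv i j p))

  τout : Fin n → Carrier
  τout i = 1# - ∑′ (λ j → when′ (adj i j) (λ p → m i j * (m j i - 1#) * qinv i j p))

  L : Matrix R n
  L i j with i Fin.≟ j
  ... | yes _ = ∑′ (λ k → when′ (adj i k) (λ p → m k i * (ainv i k p * qinv i k p)))
  ... | no  _ = when′ (adj i j) (λ p → - (m i j * (ainv i j p * qinv i j p)))

  edgeTerm : ∀ i j → Adj adj i j → Carrier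
  edgeTerm i j p = a i j * (m i j - 1#) * (m j i - 1#) * qinv i j p

  edgeSum : (Fin n → Fin n → Bool) → Carrier
  edgeSum P = ∑′ (λ u → ∑′ (λ w → when′ (adj u w) (λ q →
                if ⌊ u Fin.<? w ⌋ ∧ P u w then edgeTerm u w q else 0#)))

  α : Carrier
  α = edgeSum (λ _ _ → true)

  -- v is a node of T_{i→j}: v = i, or the path from i to v passes through j
  inSub : Fin n → Fin n → Fin n → Bool
  inSub i j v = ⌊ v Fin.≟ i ⌋ ∨ any (λ x → ⌊ x Fin.≟ j ⌋) (path adj t i v)

  module WithAlphaInv (αinv : Carrier) where

    β : Fin n → Carrier
    β i = αinv * ∑′ (λ j → when′ (adj i j) (λ p →
            ainv i j p * edgeSum (λ u w → inSub i j u ∧ inSub i j w)))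

    -- for j ≠ i, the (unique) neighbour k of i with j ∈ T_{i→k}
    -- contributes 1/a_{ik}
    C : Matrix R n
    C i j with i Fin.≟ j
    ... | yes _ = β i
    ... | no  _ = β i - ∑′ (λ k → when′ (adj i k) (λ p →
                    if inSub i k j then ainv i k p else 0#))

    Dinv : Matrix R n
    Dinv i j = αinv * (τout i * τin j) - L i j + C i j * τin j

-- Let W = α⁻¹ τ_out τ_inᵀ − L + C diag(τ_in).  Root the tree at a column index j: every vertex
-- k ≠ j has a unique neighbour k′ on its path to j, and D k j = a_kk′ (m_kk′ − 1) + m_kk′ D k′ j.
-- Summing τ_in k D k j by parts over these oriented edges, each edge contributes exactly its term
-- of α, so τ_inᵀ D = α 1ᵀ and the rank-one part of W D has entries τ_out i.  The same summation
-- restricted to a branch T_{i→l} evaluates the C-part, and row i of W D then splits over the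
-- neighbours l of i into 1 − #{l : l is the next vertex from i towards j} = δ_ij.
-- That α is invertible comes from det D: D has the right inverse E = adj D / det D, and for
-- ζ k = ∏ m along the path from k to a fixed vertex the same summation gives τ_inᵀ ζ = 1, so
-- α · 1ᵀ E ζ = τ_inᵀ D E ζ = 1.  Finally W, a left inverse of a matrix with a right inverse,
-- is a two-sided inverse.

module Submission where

open import Defs

open import Algebra.Bundles using (CommutativeRing)
open import Data.Bool using (Bool; true; false; T; not; _∧_; _∨_; if_then_else_)
open import Data.Bool.ListAction using (any)
import Data.Bool.Properties as Bool
open import Data.Empty using (⊥; ⊥-elim)
open import Data.Fin as Fin using (Fin; zero; suc; toℕ; punchIn; punchOut)
import Data.Fin.Properties as Fin
open import Data.Integer as ℤ using (ℤ; +_; -[1+_]; _⊖_)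
import Data.Integer.Properties as ℤ
open import Data.List using (List; []; _∷_; _++_; reverse; length)
open import Data.List.Membership.Propositional using (_∈_)
import Data.List.Properties as List
open import Data.List.Relation.Unary.All using ([]; _∷_)
open import Data.List.Relation.Unary.All.Properties using (¬Any⇒All¬; All¬⇒¬Any)
open import Data.List.Relation.Unary.AllPairs using ([]; _∷_)
open import Data.List.Relation.Unary.Any as Any using (here; there; any?)
open import Data.List.Relation.Unary.Any.Properties using (any⁺; any⁻; reverse⁻)
open import Data.List.Relation.Unary.Unique.Propositional using (Unique)
import Data.List.Relation.Unary.Unique.Propositional.Properties as Unique
open import Data.Maybe using (Maybe; just; nothing)
open import Data.Nat as ℕ using (ℕ; zero; suc)
import Data.Nat.Properties as ℕ
open import Data.Product using (Σ; ∃; _×_; _,_; proj₁; proj₂)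
open import Data.Sign as Sign using (Sign)
open import Data.Sum using (_⊎_; inj₁; inj₂)
open import Function using (_∘_)
open import Function.Bundles using (Equivalence)
open import Relation.Binary.Definitions using (tri<; tri≈; tri>)
open import Relation.Binary.PropositionalEquality as ≡ using (_≡_; _≢_)
open import Relation.Nullary using (Dec; yes; no; ¬_)
open import Relation.Nullary.Decidable using (⌊_⌋; toWitness; fromWitness)

-- The library instantiates the ring solver with ℕ coefficients only, which cannot cancel
-- subtraction; ℤ maps into every commutative ring.
module IntegerRingSolver {c ℓ} (R : CommutativeRing c ℓ) where
  open CommutativeRing R
  open import Algebra.Properties.Semiring.Mult.TCOptimised semiring
    using (×-homo-+; ×1-homo-*) renaming (_×_ to _×ₙ_)
  open import Algebra.Properties.Ring ring using (-‿distribˡ-*; -‿distribʳ-*)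
  open import Algebra.Properties.AbelianGroup +-abelianGroup
    using (ε⁻¹≈ε; ⁻¹-involutive; ⁻¹-∙-comm)
  open import Algebra.Solver.Ring.AlmostCommutativeRing
    using (fromCommutativeRing; _-Raw-AlmostCommutative⟶_)
  open import Relation.Binary.Reasoning.Setoid setoid

  fromℕ : ℕ → Carrier
  fromℕ k = k ×ₙ 1#

  signed : Sign → Carrier → Carrier
  signed Sign.+ x = x
  signed Sign.- x = - x

  fromℤ : ℤ → Carrier
  fromℤ i = signed (ℤ.sign i) (fromℕ ℤ.∣ i ∣)

  fromℕ-suc : ∀ k → fromℕ (suc k) ≈ 1# + fromℕ k
  fromℕ-suc k = ×-homo-+ 1# 1 k

  signed-cong : ∀ s {x y} → x ≈ y → signed s x ≈ signed s y
  signed-cong Sign.+ x≈y = x≈y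
  signed-cong Sign.- x≈y = -‿cong x≈y

  signed-* : ∀ s t x y → signed (s Sign.* t) (x * y) ≈ signed s x * signed t y
  signed-* Sign.+ Sign.+ x y = refl
  signed-* Sign.+ Sign.- x y = -‿distribʳ-* x y
  signed-* Sign.- Sign.+ x y = -‿distribˡ-* x y
  signed-* Sign.- Sign.- x y = begin
    x * y         ≈⟨ ⁻¹-involutive (x * y) ⟨
    - - (x * y)   ≈⟨ -‿cong (-‿distribʳ-* x y) ⟩
    - (x * - y)   ≈⟨ -‿distribˡ-* x (- y) ⟩
    - x * - y     ∎

  fromℤ-◃ : ∀ s k → fromℤ (s ℤ.◃ k) ≈ signed s (fromℕ k)
  fromℤ-◃ Sign.+ zero    = refl
  fromℤ-◃ Sign.- zero    = sym ε⁻¹≈ε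
  fromℤ-◃ Sign.+ (suc k) = refl
  fromℤ-◃ Sign.- (suc k) = refl

  fromℤ-⊖ : ∀ j k → fromℤ (j ⊖ k) ≈ fromℕ j - fromℕ k
  fromℤ-⊖ zero    zero    = sym (-‿inverseʳ 0#)
  fromℤ-⊖ zero    (suc k) = sym (+-identityˡ _)
  fromℤ-⊖ (suc j) zero    = sym (trans (+-congˡ ε⁻¹≈ε) (+-identityʳ _))
  fromℤ-⊖ (suc j) (suc k) = begin
    fromℤ (suc j ⊖ suc k)                      ≡⟨ ≡.cong fromℤ (ℤ.[1+m]⊖[1+n]≡m⊖n j k) ⟩
    fromℤ (j ⊖ k)                              ≈⟨ fromℤ-⊖ j k ⟩
    fromℕ j - fromℕ k                          ≈⟨ shift ⟩
    (1# + fromℕ j) - (1# + fromℕ k)            ≈⟨ +-cong (fromℕ-suc j) (-‿cong (fromℕ-suc k)) ⟨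
    fromℕ (suc j) - fromℕ (suc k)              ∎
    where
    shift : fromℕ j - fromℕ k ≈ (1# + fromℕ j) - (1# + fromℕ k)
    shift = begin
      fromℕ j - fromℕ k                        ≈⟨ +-congʳ (+-identityˡ _) ⟨
      (0# + fromℕ j) - fromℕ k                 ≈⟨ +-congʳ (+-congʳ (-‿inverseʳ 1#)) ⟨
      ((1# - 1#) + fromℕ j) - fromℕ k          ≈⟨ +-congʳ (+-assoc 1# (- 1#) _) ⟩
      (1# + (- 1# + fromℕ j)) - fromℕ k        ≈⟨ +-congʳ (+-congˡ (+-comm (- 1#) _)) ⟩
      (1# + (fromℕ j - 1#)) - fromℕ k          ≈⟨ +-congʳ (+-assoc 1# _ _) ⟨
      ((1# + fromℕ j) - 1#) - fromℕ k          ≈⟨ +-assoc _ (- 1#) _ ⟩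
      (1# + fromℕ j) + (- 1# - fromℕ k)        ≈⟨ +-congˡ (⁻¹-∙-comm 1# _) ⟩
      (1# + fromℕ j) - (1# + fromℕ k)          ∎

  fromℤ-+ : ∀ i j → fromℤ (i ℤ.+ j) ≈ fromℤ i + fromℤ j
  fromℤ-+ -[1+ j ] -[1+ k ] = begin
    - fromℕ (suc (suc (j ℕ.+ k)))             ≡⟨ ≡.cong (λ l → - fromℕ (suc l)) (≡.sym (ℕ.+-suc j k)) ⟩
    - fromℕ (suc j ℕ.+ suc k)                 ≈⟨ -‿cong (×-homo-+ 1# (suc j) (suc k)) ⟩
    - (fromℕ (suc j) + fromℕ (suc k))         ≈⟨ ⁻¹-∙-comm _ _ ⟨
    - fromℕ (suc j) - fromℕ (suc k)           ∎
  fromℤ-+ -[1+ j ] (+ k)    = trans (fromℤ-⊖ k (suc j)) (+-comm _ _)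
  fromℤ-+ (+ j)    -[1+ k ] = fromℤ-⊖ j (suc k)
  fromℤ-+ (+ j)    (+ k)    = ×-homo-+ 1# j k

  fromℤ-* : ∀ i j → fromℤ (i ℤ.* j) ≈ fromℤ i * fromℤ j
  fromℤ-* i j = begin
    fromℤ ((ℤ.sign i Sign.* ℤ.sign j) ℤ.◃ (ℤ.∣ i ∣ ℕ.* ℤ.∣ j ∣))
      ≈⟨ fromℤ-◃ (ℤ.sign i Sign.* ℤ.sign j) (ℤ.∣ i ∣ ℕ.* ℤ.∣ j ∣) ⟩
    signed (ℤ.sign i Sign.* ℤ.sign j) (fromℕ (ℤ.∣ i ∣ ℕ.* ℤ.∣ j ∣))
      ≈⟨ signed-cong (ℤ.sign i Sign.* ℤ.sign j) (×1-homo-* ℤ.∣ i ∣ ℤ.∣ j ∣) ⟩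
    signed (ℤ.sign i Sign.* ℤ.sign j) (fromℕ ℤ.∣ i ∣ * fromℕ ℤ.∣ j ∣)
      ≈⟨ signed-* (ℤ.sign i) (ℤ.sign j) _ _ ⟩
    fromℤ i * fromℤ j ∎

  fromℤ-neg : ∀ i → fromℤ (ℤ.- i) ≈ - fromℤ i
  fromℤ-neg -[1+ k ]      = sym (⁻¹-involutive _)
  fromℤ-neg (+ zero)      = sym ε⁻¹≈ε
  fromℤ-neg (+ suc k)     = refl

  fromℤ-homomorphism : ℤ.+-*-rawRing -Raw-AlmostCommutative⟶ fromCommutativeRing R
  fromℤ-homomorphism = record
    { ⟦_⟧    = fromℤ
    ; +-homo = fromℤ-+
    ; *-homo = fromℤ-*
    ; -‿homo = fromℤ-neg
    ; 0-homo = refl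
    ; 1-homo = refl
    }

  fromℤ-≟ : ∀ i j → Maybe (fromℤ i ≈ fromℤ j)
  fromℤ-≟ i j with i ℤ.≟ j
  ... | yes ≡.refl = just refl
  ... | no _       = nothing

  open import Algebra.Solver.Ring ℤ.+-*-rawRing (fromCommutativeRing R) fromℤ-homomorphism fromℤ-≟
    public

  :0 :1 : ∀ {k} → Polynomial k
  :0 = con (+ 0)
  :1 = con (+ 1)

module _ {p} {P : Set p} where

  ⌊⌋-yes : (d : Dec P) → P → ⌊ d ⌋ ≡ true
  ⌊⌋-yes (yes _) _ = ≡.refl
  ⌊⌋-yes (no ¬p) p = ⊥-elim (¬p p)

  ⌊⌋-no : (d : Dec P) → ¬ P → ⌊ d ⌋ ≡ false
  ⌊⌋-no (yes p) ¬p = ⊥-elim (¬p p)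
  ⌊⌋-no (no _)  _  = ≡.refl

  ⌊⌋-true : (d : Dec P) → ⌊ d ⌋ ≡ true → P
  ⌊⌋-true (yes p) _ = p

  module _ {a} {A : Set a} {x y : A} where

    if-yes : (d : Dec P) → P → (if ⌊ d ⌋ then x else y) ≡ x
    if-yes d p = ≡.cong (if_then x else y) (⌊⌋-yes d p)

    if-no : (d : Dec P) → ¬ P → (if ⌊ d ⌋ then x else y) ≡ y
    if-no d ¬p = ≡.cong (if_then x else y) (⌊⌋-no d ¬p)

Unique-reverse : ∀ {a} {A : Set a} {xs : List A} → Unique xs → Unique (reverse xs)
Unique-reverse [] = []
Unique-reverse {xs = x ∷ xs} (x∉xs ∷ u) = ≡.subst Unique (≡.sym (List.unfold-reverse x xs))
  (Unique.++⁺ (Unique-reverse u) ([] ∷ []) λ { (x∈ , here ≡.refl) → All¬⇒¬Any x∉xs (reverse⁻ x∈) })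

module RingLemmas {c ℓ} (R : CommutativeRing c ℓ) where
  open CommutativeRing R
  open import Relation.Binary.Reasoning.Setoid setoid

  inverse-unique : ∀ {x x′ y y′} → x ≈ x′ → x * y ≈ 1# → x′ * y′ ≈ 1# → y ≈ y′
  inverse-unique {x} {x′} {y} {y′} x≈x′ xy≈1 x′y′≈1 = begin
    y              ≈⟨ *-identityʳ y ⟨
    y * 1#         ≈⟨ *-congˡ x′y′≈1 ⟨
    y * (x′ * y′)  ≈⟨ *-congˡ (*-congʳ x≈x′) ⟨
    y * (x * y′)   ≈⟨ *-assoc y x y′ ⟨
    (y * x) * y′   ≈⟨ *-congʳ (trans (*-comm y x) xy≈1) ⟩
    1# * y′        ≈⟨ *-identityˡ y′ ⟩
    y′             ∎

  *-[u-1]≈0 : ∀ x {u} → u ≈ 1# → x * (u - 1#) ≈ 0#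
  *-[u-1]≈0 x u≈1 = trans (*-congˡ (trans (+-congʳ u≈1) (-‿inverseʳ 1#))) (zeroʳ x)

  if-true : ∀ {b : Bool} {x y : Carrier} → b ≡ true → (if b then x else y) ≈ x
  if-true ≡.refl = refl

  if-false : ∀ {b : Bool} {x y : Carrier} → b ≡ false → (if b then x else y) ≈ y
  if-false ≡.refl = refl

  when-yes : ∀ {b} (f : T b → Carrier) (p : T b) → when R b f ≈ f p
  when-yes {true} f p = refl

  when-no : ∀ {b} (f : T b → Carrier) → ¬ T b → when R b f ≈ 0#
  when-no {false} f _  = refl
  when-no {true}  f ¬p = ⊥-elim (¬p _)

  when-if : ∀ b c (f : T b → Carrier) → when R b (λ p → if c then f p else 0#) ≈ (if c then when R b f else 0#)
  when-if true  c     f = refl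
  when-if false true  f = refl
  when-if false false f = refl

  when-cong : ∀ b {f g : T b → Carrier} → (∀ p → f p ≈ g p) → when R b f ≈ when R b g
  when-cong true  f≈g = f≈g _
  when-cong false f≈g = refl

  when-*ʳ : ∀ b (f : T b → Carrier) x → when R b f * x ≈ when R b (λ p → f p * x)
  when-*ʳ true  f x = refl
  when-*ʳ false f x = zeroˡ x

  when-- : ∀ b (f g : T b → Carrier) → when R b f - when R b g ≈ when R b (λ p → f p - g p)
  when-- true  f g = refl
  when-- false f g = -‿inverseʳ 0#

module Sums {c ℓ} (R : CommutativeRing c ℓ) where
  open CommutativeRing R hiding (zero)
  open import Algebra.Properties.Semiring.Sum semiring public
    using (sum; sum-cong-≋; ∑-distrib-+; ∑-comm; sum-remove; *-distribˡ-sum; *-distribʳ-sum)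
  open import Algebra.Properties.AbelianGroup +-abelianGroup using (ε⁻¹≈ε; ⁻¹-∙-comm)
  open import Relation.Binary.Reasoning.Setoid setoid

  sum-0 : ∀ {n} {f : Fin n → Carrier} → (∀ i → f i ≈ 0#) → sum f ≈ 0#
  sum-0 {zero}  f≈0 = refl
  sum-0 {suc n} f≈0 = trans (+-cong (f≈0 zero) (sum-0 (f≈0 ∘ suc))) (+-identityʳ 0#)

  sum-neg : ∀ {n} (f : Fin n → Carrier) → sum (λ i → - f i) ≈ - sum f
  sum-neg {zero}  f = sym ε⁻¹≈ε
  sum-neg {suc n} f = trans (+-congˡ (sum-neg (f ∘ suc))) (⁻¹-∙-comm _ _)

  ∑-distrib-- : ∀ {n} (f g : Fin n → Carrier) → sum (λ i → f i - g i) ≈ sum f - sum g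
  ∑-distrib-- f g = trans (∑-distrib-+ f (λ i → - g i)) (+-congˡ (sum-neg g))

  sum-concentrated : ∀ {n} (f : Fin n → Carrier) k → (∀ i → i ≢ k → f i ≈ 0#) → sum f ≈ f k
  sum-concentrated {suc n} f k f≈0 = begin
    sum f                             ≈⟨ sum-remove {i = k} f ⟩
    f k + sum (λ l → f (punchIn k l))  ≈⟨ +-congˡ (sum-0 (λ l → f≈0 _ (Fin.punchInᵢ≢i k l))) ⟩
    f k + 0#                          ≈⟨ +-identityʳ _ ⟩
    f k                               ∎

  sum₂ : ∀ {m n} → (Fin m → Fin n → Carrier) → Carrier
  sum₂ f = sum (λ k → sum (f k))

  sum₂-cong : ∀ {m n} {f g : Fin m → Fin n → Carrier} → (∀ k l → f k l ≈ g k l) → sum₂ f ≈ sum₂ g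
  sum₂-cong {f = f} {g} f≈g =
    sum-cong-≋ {x = λ k → sum (f k)} {y = λ k → sum (g k)} (λ k → sum-cong-≋ (f≈g k))

  sum₂-0 : ∀ {m n} {f : Fin m → Fin n → Carrier} → (∀ k l → f k l ≈ 0#) → sum₂ f ≈ 0#
  sum₂-0 f≈0 = sum-0 (λ k → sum-0 (f≈0 k))

  sum₂-distrib-+ : ∀ {m n} (f g : Fin m → Fin n → Carrier) → sum₂ (λ k l → f k l + g k l) ≈ sum₂ f + sum₂ g
  sum₂-distrib-+ f g =
    trans (sum-cong-≋ (λ k → ∑-distrib-+ (f k) (g k))) (∑-distrib-+ (λ k → sum (f k)) (λ k → sum (g k)))

  sum₂-distrib-- : ∀ {m n} (f g : Fin m → Fin n → Carrier) → sum₂ (λ k l → f k l - g k l) ≈ sum₂ f - sum₂ g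
  sum₂-distrib-- f g =
    trans (sum-cong-≋ (λ k → ∑-distrib-- (f k) (g k))) (∑-distrib-- (λ k → sum (f k)) (λ k → sum (g k)))

  pointMass : ∀ {n} → Fin n → Fin n → Carrier → Fin n → Fin n → Carrier
  pointMass u w z k k′ = if ⌊ k Fin.≟ u ⌋ ∧ ⌊ k′ Fin.≟ w ⌋ then z else 0#

  pointMass-off : ∀ {n} (u w : Fin n) z k k′ → (k ≢ u ⊎ k′ ≢ w) → pointMass u w z k k′ ≈ 0#
  pointMass-off u w z k k′ (inj₁ k≢u) rewrite ⌊⌋-no (k Fin.≟ u) k≢u = refl
  pointMass-off u w z k k′ (inj₂ k′≢w) rewrite ⌊⌋-no (k′ Fin.≟ w) k′≢w
    = reflexive (≡.cong (if_then z else 0#) (Bool.∧-zeroʳ ⌊ k Fin.≟ u ⌋))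

  pointMass-at : ∀ {n} (u w : Fin n) z → pointMass u w z u w ≈ z
  pointMass-at u w z rewrite ⌊⌋-yes (u Fin.≟ u) ≡.refl | ⌊⌋-yes (w Fin.≟ w) ≡.refl = refl

  pointMass-guarded : ∀ {n} (b : Fin n → Fin n → Bool) {u w k k′} z → b k k′ ≡ false →
    pointMass u w (if b u w then z else 0#) k k′ ≈ 0#
  pointMass-guarded b {u} {w} {k} {k′} z bkk′≡false with k Fin.≟ u | k′ Fin.≟ w
  ... | yes ≡.refl | yes ≡.refl rewrite bkk′≡false = refl
  ... | yes _      | no _       = refl
  ... | no _       | _          = refl

  sum₂-pointMass : ∀ {n} (u w : Fin n) z → sum₂ (pointMass u w z) ≈ z
  sum₂-pointMass u w z = begin
    sum₂ (pointMass u w z)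
      ≈⟨ sum-concentrated _ u (λ k k≢u → sum-0 (λ k′ → pointMass-off u w z k k′ (inj₁ k≢u))) ⟩
    sum (pointMass u w z u)
      ≈⟨ sum-concentrated _ w (λ k′ k′≢w → pointMass-off u w z u k′ (inj₂ k′≢w)) ⟩
    pointMass u w z u w
      ≈⟨ pointMass-at u w z ⟩
    z ∎

  sum-when : ∀ b {n} (f : Fin n → T b → Carrier) →
    sum (λ k → when R b (f k)) ≈ when R b (λ p → sum (λ k → f k p))
  sum-when true  f = refl
  sum-when false {n} f = sum-0 {n} {λ _ → 0#} (λ _ → refl)

module Matrices {c ℓ} (R : CommutativeRing c ℓ) where
  open CommutativeRing R hiding (zero)
  open Sums R
  open import Relation.Binary.Reasoning.Setoid setoid

  infixl 7 _*ᴹ_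
  _*ᴹ_ : ∀ {n} → Matrix R n → Matrix R n → Matrix R n
  _*ᴹ_ = _*M_ R

  1ᴹ : ∀ {n} → Matrix R n
  1ᴹ = idM R

  infix 4 _≋_
  _≋_ : ∀ {n} → Matrix R n → Matrix R n → Set ℓ
  A ≋ B = ∀ i j → A i j ≈ B i j

  *ᴹ-congˡ : ∀ {n} {A A′ : Matrix R n} (B : Matrix R n) → A ≋ A′ → A *ᴹ B ≋ A′ *ᴹ B
  *ᴹ-congˡ B A≋A′ i j = sum-cong-≋ (λ k → *-congʳ (A≋A′ i k))

  *ᴹ-congʳ : ∀ {n} (A : Matrix R n) {B B′ : Matrix R n} → B ≋ B′ → A *ᴹ B ≋ A *ᴹ B′
  *ᴹ-congʳ A B≋B′ i j = sum-cong-≋ (λ k → *-congˡ (B≋B′ k j))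

  infix 6 _·_
  _·_ : ∀ {n} → (Fin n → Carrier) → (Fin n → Carrier) → Carrier
  u · v = sum (λ k → u k * v k)

  infixr 7 _⊳_
  _⊳_ : ∀ {n} → Matrix R n → (Fin n → Carrier) → Fin n → Carrier
  (A ⊳ v) k = A k · v

  infixl 7 _⊲_
  _⊲_ : ∀ {n} → (Fin n → Carrier) → Matrix R n → Fin n → Carrier
  (u ⊲ A) l = sum (λ k → u k * A k l)

  ·-congʳ : ∀ {n} (u : Fin n → Carrier) {v v′} → (∀ k → v k ≈ v′ k) → u · v ≈ u · v′
  ·-congʳ u v≈v′ = sum-cong-≋ (λ k → *-congˡ (v≈v′ k))

  ⊳-congˡ : ∀ {n} {A B : Matrix R n} {v} → A ≋ B → ∀ k → (A ⊳ v) k ≈ (B ⊳ v) k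
  ⊳-congˡ A≋B k = sum-cong-≋ (λ l → *-congʳ (A≋B k l))

  ·-⊳ : ∀ {n} (u : Fin n → Carrier) A v → u · (A ⊳ v) ≈ (u ⊲ A) · v
  ·-⊳ u A v = begin
    sum (λ k → u k * sum (λ l → A k l * v l))    ≈⟨ sum-cong-≋ (λ k → *-distribˡ-sum (u k) (λ l → A k l * v l)) ⟩
    sum₂ (λ k l → u k * (A k l * v l))          ≈⟨ ∑-comm (λ k l → u k * (A k l * v l)) ⟩
    sum₂ (λ l k → u k * (A k l * v l))          ≈⟨ sum₂-cong (λ l k → *-assoc (u k) (A k l) (v l)) ⟨
    sum₂ (λ l k → u k * A k l * v l)            ≈⟨ sum-cong-≋ (λ l → *-distribʳ-sum (v l) (λ k → u k * A k l)) ⟨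
    sum (λ l → sum (λ k → u k * A k l) * v l)    ∎

  *ᴹ-⊳ : ∀ {n} (A B : Matrix R n) v k → ((A *ᴹ B) ⊳ v) k ≈ (A ⊳ B ⊳ v) k
  *ᴹ-⊳ A B v k = begin
    sum (λ j → sum (λ l → A k l * B l j) * v j)  ≈⟨ sum-cong-≋ (λ j → *-distribʳ-sum (v j) (λ l → A k l * B l j)) ⟩
    sum₂ (λ j l → A k l * B l j * v j)          ≈⟨ ∑-comm (λ j l → A k l * B l j * v j) ⟩
    sum₂ (λ l j → A k l * B l j * v j)          ≈⟨ sum₂-cong (λ l j → *-assoc (A k l) (B l j) (v j)) ⟩
    sum₂ (λ l j → A k l * (B l j * v j))        ≈⟨ sum-cong-≋ (λ l → *-distribˡ-sum (A k l) (λ j → B l j * v j)) ⟨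
    sum (λ l → A k l * sum (λ j → B l j * v j))  ∎

  1ᴹ-⊳ : ∀ {n} (v : Fin n → Carrier) i → (1ᴹ ⊳ v) i ≈ v i
  1ᴹ-⊳ v i = begin
    sum (λ k → 1ᴹ i k * v k)
      ≈⟨ sum-concentrated _ i (λ k k≢i → trans (*-congʳ (reflexive (if-no (i Fin.≟ k) (k≢i ∘ ≡.sym)))) (zeroˡ _)) ⟩
    1ᴹ i i * v i
      ≈⟨ trans (*-congʳ (reflexive (if-yes (i Fin.≟ i) ≡.refl))) (*-identityˡ _) ⟩
    v i ∎

  1ᴹ-sym : ∀ {n} (i j : Fin n) → 1ᴹ i j ≈ 1ᴹ j i
  1ᴹ-sym i j with i Fin.≟ j | j Fin.≟ i
  ... | yes _   | yes _   = refl
  ... | no _    | no _    = refl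
  ... | yes i≡j | no j≢i  = ⊥-elim (j≢i (≡.sym i≡j))
  ... | no i≢j  | yes j≡i = ⊥-elim (i≢j (≡.sym j≡i))

  *ᴹ-identityˡ : ∀ {n} (A : Matrix R n) → 1ᴹ *ᴹ A ≋ A
  *ᴹ-identityˡ A i j = 1ᴹ-⊳ (λ k → A k j) i

  *ᴹ-identityʳ : ∀ {n} (A : Matrix R n) → A *ᴹ 1ᴹ ≋ A
  *ᴹ-identityʳ A i j = trans (sum-cong-≋ (λ k → trans (*-comm (A i k) _) (*-congʳ (1ᴹ-sym k j)))) (1ᴹ-⊳ (A i) j)

  *ᴹ-assoc : ∀ {n} (A B C : Matrix R n) → (A *ᴹ B) *ᴹ C ≋ A *ᴹ (B *ᴹ C)
  *ᴹ-assoc A B C i j = *ᴹ-⊳ A B (λ l → C l j) i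

  leftInverse≋rightInverse : ∀ {n} {A L R′ : Matrix R n} → L *ᴹ A ≋ 1ᴹ → A *ᴹ R′ ≋ 1ᴹ → L ≋ R′
  leftInverse≋rightInverse {A = A} {L} {R′} LA≋1 AR′≋1 i j = begin
    L i j                ≈⟨ *ᴹ-identityʳ L i j ⟨
    (L *ᴹ 1ᴹ) i j        ≈⟨ *ᴹ-congʳ L AR′≋1 i j ⟨
    (L *ᴹ (A *ᴹ R′)) i j ≈⟨ *ᴹ-assoc L A R′ i j ⟨
    ((L *ᴹ A) *ᴹ R′) i j ≈⟨ *ᴹ-congˡ R′ LA≋1 i j ⟩
    (1ᴹ *ᴹ R′) i j       ≈⟨ *ᴹ-identityˡ R′ i j ⟩
    R′ i j               ∎

  leftInverse⇒rightInverse : ∀ {n} {A L R′ : Matrix R n} → L *ᴹ A ≋ 1ᴹ → A *ᴹ R′ ≋ 1ᴹ → A *ᴹ L ≋ 1ᴹ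
  leftInverse⇒rightInverse {A = A} LA≋1 AR′≋1 i j =
    trans (*ᴹ-congʳ A (leftInverse≋rightInverse LA≋1 AR′≋1) i j) (AR′≋1 i j)

-- The index of column c once column k is deleted; an arbitrary value when c = k.
punchOut′ : ∀ {m} → Fin (suc (suc m)) → Fin (suc (suc m)) → Fin (suc m)
punchOut′ zero    zero    = zero
punchOut′ zero    (suc c) = c
punchOut′ (suc k) zero    = zero
punchOut′ {zero}  (suc k) (suc c) = zero
punchOut′ {suc m} (suc k) (suc c) = suc (punchOut′ k c)

punchOut′-punchIn : ∀ {m} (k : Fin (suc (suc m))) (l : Fin (suc m)) → punchOut′ k (punchIn k l) ≡ l
punchOut′-punchIn zero    l       = ≡.refl
punchOut′-punchIn (suc k) zero    = ≡.refl
punchOut′-punchIn {suc m} (suc k) (suc l) = ≡.cong suc (punchOut′-punchIn k l)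

punchIn-punchIn-comm : ∀ {m} (c : Fin (suc (suc m))) (l : Fin (suc m)) (b : Fin m) →
  punchIn (punchIn c l) (punchIn (punchOut′ (punchIn c l) c) b) ≡ punchIn c (punchIn l b)
punchIn-punchIn-comm zero    l       b       = ≡.refl
punchIn-punchIn-comm (suc c) zero    b       = ≡.refl
punchIn-punchIn-comm {suc m} (suc c) (suc l) zero    = ≡.refl
punchIn-punchIn-comm {suc m} (suc c) (suc l) (suc b) = ≡.cong suc (punchIn-punchIn-comm c l b)

module Determinant {c ℓ} (R : CommutativeRing c ℓ) where
  open CommutativeRing R hiding (zero)
  open Sums R
  open Matrices R
  open IntegerRingSolver R using (solve; _:=_; _:*_; :-_)
  open import Algebra.Properties.Ring ring using (-‿distribˡ-*)
  open import Algebra.Properties.AbelianGroup +-abelianGroup using (⁻¹-involutive)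
  open import Relation.Binary.Reasoning.Setoid setoid

  sign : ∀ {n} → Fin n → Carrier
  sign j = sgn R (toℕ j)

  sgn-+ : ∀ a b → sgn R (a ℕ.+ b) ≈ sgn R a * sgn R b
  sgn-+ zero    b = sym (*-identityˡ _)
  sgn-+ (suc a) b = trans (-‿cong (sgn-+ a b)) (-‿distribˡ-* _ _)

  sign-punchIn-punchOut′ : ∀ {m} (c : Fin (suc (suc m))) (l : Fin (suc m)) →
    sign (punchIn c l) * sign (punchOut′ (punchIn c l) c) ≈ - (sign c * sign l)
  sign-punchIn-punchOut′ zero    l    = trans (*-identityʳ _) (-‿cong (sym (*-identityˡ _)))
  sign-punchIn-punchOut′ (suc c) zero =
    trans (*-identityˡ _) (trans (sym (⁻¹-involutive _)) (-‿cong (sym (*-identityʳ _))))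
  sign-punchIn-punchOut′ {suc m} (suc c) (suc l) = begin
    - sign (punchIn c l) * - sign (punchOut′ (punchIn c l) c)  ≈⟨ negate² _ _ ⟩
    sign (punchIn c l) * sign (punchOut′ (punchIn c l) c)      ≈⟨ sign-punchIn-punchOut′ c l ⟩
    - (sign c * sign l)                                       ≈⟨ -‿cong (negate² _ _) ⟨
    - (- sign c * - sign l)                                   ∎
    where
    negate² : ∀ x y → - x * - y ≈ x * y
    negate² = solve 2 (λ x y → (:- x) :* (:- y) := x :* y) refl

  minor : ∀ {n} → Fin (suc n) → Fin (suc n) → Matrix R (suc n) → Matrix R n
  minor j k M a b = M (punchIn j a) (punchIn k b)

  laplaceTerm : ∀ {n} → Matrix R (suc n) → Fin (suc n) → Fin (suc n) → Carrier
  laplaceTerm M j k = sgn R (toℕ j ℕ.+ toℕ k) * (M j k * det R (minor j k M))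

  det-cong : ∀ {n} {M M′ : Matrix R n} → M ≋ M′ → det R M ≈ det R M′
  det-cong {zero}  M≋M′ = refl
  det-cong {suc n} {M} {M′} M≋M′ = sum-cong-≋ {x = laplaceTerm M zero} {y = laplaceTerm M′ zero}
    (λ k → *-congˡ (*-cong (M≋M′ zero k) (det-cong (λ a b → M≋M′ (suc a) (punchIn k b)))))

  offDiagonalSum : ∀ {m} → (Fin m → Fin m → Carrier) → Carrier
  offDiagonalSum f = sum₂ (λ k c → if ⌊ k Fin.≟ c ⌋ then 0# else f k c)

  sum-punchIn≈offDiagonalSum : ∀ {m} (f : Fin (suc m) → Fin (suc m) → Carrier) →
    sum₂ (λ k l → f k (punchIn k l)) ≈ offDiagonalSum f
  sum-punchIn≈offDiagonalSum f = sum-cong-≋ (λ k → sym (begin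
    sum (λ c → if ⌊ k Fin.≟ c ⌋ then 0# else f k c)
      ≈⟨ sum-remove {i = k} (λ c → if ⌊ k Fin.≟ c ⌋ then 0# else f k c) ⟩
    (if ⌊ k Fin.≟ k ⌋ then 0# else f k k) + sum (λ l → if ⌊ k Fin.≟ punchIn k l ⌋ then 0# else f k (punchIn k l))
      ≈⟨ +-cong (reflexive (if-yes (k Fin.≟ k) ≡.refl))
                (sum-cong-≋ (λ l → reflexive (if-no (k Fin.≟ punchIn k l) (Fin.punchInᵢ≢i k l ∘ ≡.sym)))) ⟩
    0# + sum (λ l → f k (punchIn k l))
      ≈⟨ +-identityˡ _ ⟩
    sum (λ l → f k (punchIn k l)) ∎))

  offDiagonalSum-transpose : ∀ {m} (f : Fin m → Fin m → Carrier) →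
    offDiagonalSum f ≈ offDiagonalSum (λ k c → f c k)
  offDiagonalSum-transpose f = trans (∑-comm (λ k c → if ⌊ k Fin.≟ c ⌋ then 0# else f k c))
    (sum₂-cong (λ c k → reflexive (≡.cong (if_then 0# else f k c) (≟-sym k c))))
    where
    ≟-sym : ∀ {m} (k c : Fin m) → ⌊ k Fin.≟ c ⌋ ≡ ⌊ c Fin.≟ k ⌋
    ≟-sym k c with k Fin.≟ c | c Fin.≟ k
    ... | yes _   | yes _   = ≡.refl
    ... | no _    | no _    = ≡.refl
    ... | yes k≡c | no c≢k  = ⊥-elim (c≢k (≡.sym k≡c))
    ... | no k≢c  | yes c≡k = ⊥-elim (k≢c (≡.sym c≡k))

  sum-punchIn-swap : ∀ {m} (f : Fin (suc m) → Fin (suc m) → Carrier) →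
    sum₂ (λ k l → f k (punchIn k l)) ≈ sum₂ (λ c l → f (punchIn c l) c)
  sum-punchIn-swap f = begin
    sum₂ (λ k l → f k (punchIn k l))  ≈⟨ sum-punchIn≈offDiagonalSum f ⟩
    offDiagonalSum f                  ≈⟨ offDiagonalSum-transpose f ⟩
    offDiagonalSum (λ c k → f k c)    ≈⟨ sum-punchIn≈offDiagonalSum (λ c k → f k c) ⟨
    sum₂ (λ c l → f (punchIn c l) c)  ∎

  offDiagonalSum-antisym : ∀ {m} (f : Fin m → Fin m → Carrier) →
    (∀ k c → k ≢ c → f c k ≈ - f k c) → offDiagonalSum f ≈ 0#
  offDiagonalSum-antisym f antisym = begin
    offDiagonalSum f                        ≈⟨ sum₂-cong split ⟩
    sum₂ (λ k c → above k c + above′ c k)  ≈⟨ sum₂-distrib-+ above (λ k c → above′ c k) ⟩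
    sum₂ above + sum₂ (λ k c → above′ c k) ≈⟨ +-congˡ (∑-comm (λ k c → above′ c k)) ⟩
    sum₂ above + sum₂ above′               ≈⟨ sum₂-distrib-+ above above′ ⟨
    sum₂ (λ k c → above k c + above′ k c)  ≈⟨ sum₂-0 cancel ⟩
    0#                                     ∎
    where
    above above′ : _ → _ → Carrier
    above  k c = if ⌊ k Fin.<? c ⌋ then f k c else 0#
    above′ k c = if ⌊ k Fin.<? c ⌋ then f c k else 0#
    split : ∀ k c → (if ⌊ k Fin.≟ c ⌋ then 0# else f k c) ≈ above k c + above′ c k
    split k c with Fin.<-cmp k c
    ... | tri< k<c k≢c c≮k = begin
      (if ⌊ k Fin.≟ c ⌋ then 0# else f k c)  ≈⟨ reflexive (if-no (k Fin.≟ c) k≢c) ⟩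
      f k c                                  ≈⟨ +-identityʳ _ ⟨
      f k c + 0#
        ≈⟨ +-cong (reflexive (if-yes (k Fin.<? c) k<c)) (reflexive (if-no (c Fin.<? k) c≮k)) ⟨
      above k c + above′ c k ∎
    ... | tri≈ k≮c k≡c c≮k = begin
      (if ⌊ k Fin.≟ c ⌋ then 0# else f k c)  ≈⟨ reflexive (if-yes (k Fin.≟ c) k≡c) ⟩
      0#                                     ≈⟨ +-identityʳ _ ⟨
      0# + 0#
        ≈⟨ +-cong (reflexive (if-no (k Fin.<? c) k≮c)) (reflexive (if-no (c Fin.<? k) c≮k)) ⟨
      above k c + above′ c k ∎
    ... | tri> k≮c k≢c c<k = begin
      (if ⌊ k Fin.≟ c ⌋ then 0# else f k c)  ≈⟨ reflexive (if-no (k Fin.≟ c) k≢c) ⟩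
      f k c                                  ≈⟨ +-identityˡ _ ⟨
      0# + f k c
        ≈⟨ +-cong (reflexive (if-no (k Fin.<? c) k≮c)) (reflexive (if-yes (c Fin.<? k) c<k)) ⟨
      above k c + above′ c k ∎
    cancel : ∀ k c → above k c + above′ k c ≈ 0#
    cancel k c with k Fin.<? c
    ... | yes k<c = trans (+-congˡ (antisym k c (λ k≡c → Fin.<-irrefl k≡c k<c))) (-‿inverseʳ _)
    ... | no _    = +-identityʳ 0#

  doubleMinor : ∀ {n} → Matrix R (suc (suc n)) → Fin (suc n) → (k c : Fin (suc (suc n))) → Matrix R n
  doubleMinor M j′ k c = minor j′ (punchOut′ k c) (minor zero k M)

  doubleTerm : ∀ {n} → Matrix R (suc (suc n)) → Fin (suc n) → (k c : Fin (suc (suc n))) → Carrier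
  doubleTerm M j′ k c = sign j′ * (sign k * sign (punchOut′ k c))
                        * (M zero k * (M (suc j′) c * det R (doubleMinor M j′ k c)))

  doubleMinor-swap : ∀ {n} (M : Matrix R (suc (suc n))) j′ c l →
    doubleMinor M j′ (punchIn c l) c ≋ minor zero l (minor (suc j′) c M)
  doubleMinor-swap M j′ c l a b = reflexive (≡.cong (M (suc (punchIn j′ a))) (punchIn-punchIn-comm c l b))

  *₂-distribˡ-sum : ∀ {n} x y (f : Fin n → Carrier) → x * (y * sum f) ≈ sum (λ l → x * (y * f l))
  *₂-distribˡ-sum x y f = trans (*-congˡ (*-distribˡ-sum y f)) (*-distribˡ-sum x (λ l → y * f l))

  -- Expanding along row 0 and then along row j′ of each minor gives a double sum over pairs of
  -- distinct columns, which can be summed in either order.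
  mutual
    det-laplace : ∀ {n} (M : Matrix R (suc n)) j → det R M ≈ sum (laplaceTerm M j)
    det-laplace M zero = refl
    det-laplace {suc n} M (suc j′) = begin
      det R M                                                   ≈⟨ det-expand-twice M j′ ⟩
      sum₂ (λ k l → doubleTerm M j′ k (punchIn k l))          ≈⟨ sum-punchIn-swap (doubleTerm M j′) ⟩
      sum₂ (λ c l → doubleTerm M j′ (punchIn c l) c)          ≈⟨ sum-cong-≋ row ⟩
      sum (laplaceTerm M (suc j′))                              ∎
      where
      row : ∀ c → sum (λ l → doubleTerm M j′ (punchIn c l) c) ≈ laplaceTerm M (suc j′) c
      row c = trans (sum-cong-≋ term) (sym (*₂-distribˡ-sum _ _ (laplaceTerm (minor (suc j′) c M) zero)))
        where
        term : ∀ l → doubleTerm M j′ (punchIn c l) c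
                     ≈ sgn R (suc (toℕ j′ ℕ.+ toℕ c)) * (M (suc j′) c * laplaceTerm (minor (suc j′) c M) zero l)
        term l = begin
          sign j′ * (sign (punchIn c l) * sign (punchOut′ (punchIn c l) c)) * (M zero (punchIn c l) * (M (suc j′) c * Δ))
            ≈⟨ *-cong (*-congˡ (sign-punchIn-punchOut′ c l)) (*-congˡ (*-congˡ (det-cong (doubleMinor-swap M j′ c l)))) ⟩
          sign j′ * - (sign c * sign l) * (M zero (punchIn c l) * (M (suc j′) c * Δ′))
            ≈⟨ solve 6 (λ sj sc sl A B Δ → sj :* (:- (sc :* sl)) :* (A :* (B :* Δ))
                                       := (:- (sj :* sc)) :* (B :* (sl :* (A :* Δ))))
                       refl (sign j′) (sign c) (sign l) (M zero (punchIn c l)) (M (suc j′) c) Δ′ ⟩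
          - (sign j′ * sign c) * (M (suc j′) c * (sign l * (M zero (punchIn c l) * Δ′)))
            ≈⟨ *-congʳ (-‿cong (sgn-+ (toℕ j′) (toℕ c))) ⟨
          sgn R (suc (toℕ j′ ℕ.+ toℕ c)) * (M (suc j′) c * (sign l * (M zero (punchIn c l) * Δ′))) ∎
          where
          Δ  = det R (doubleMinor M j′ (punchIn c l) c)
          Δ′ = det R (minor zero l (minor (suc j′) c M))

    det-expand-twice : ∀ {n} (M : Matrix R (suc (suc n))) j′ →
      det R M ≈ sum₂ (λ k l → doubleTerm M j′ k (punchIn k l))
    det-expand-twice M j′ = sum-cong-≋ (λ k → begin
      sign k * (M zero k * det R (minor zero k M))
        ≈⟨ *-congˡ (*-congˡ (det-laplace (minor zero k M) j′)) ⟩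
      sign k * (M zero k * sum (laplaceTerm (minor zero k M) j′))
        ≈⟨ *₂-distribˡ-sum _ _ (laplaceTerm (minor zero k M) j′) ⟩
      sum (λ l → sign k * (M zero k * laplaceTerm (minor zero k M) j′ l))
        ≈⟨ sum-cong-≋ (term k) ⟩
      sum (λ l → doubleTerm M j′ k (punchIn k l)) ∎)
      where
      term : ∀ k l → sign k * (M zero k * laplaceTerm (minor zero k M) j′ l) ≈ doubleTerm M j′ k (punchIn k l)
      term k l rewrite punchOut′-punchIn k l = begin
        sign k * (M zero k * (sgn R (toℕ j′ ℕ.+ toℕ l) * (M (suc j′) (punchIn k l) * Δ)))
          ≈⟨ *-congˡ (*-congˡ (*-congʳ (sgn-+ (toℕ j′) (toℕ l)))) ⟩
        sign k * (M zero k * ((sign j′ * sign l) * (M (suc j′) (punchIn k l) * Δ)))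
          ≈⟨ solve 6 (λ sk A sj sl B Δ → sk :* (A :* ((sj :* sl) :* (B :* Δ))) := sj :* (sk :* sl) :* (A :* (B :* Δ)))
                     refl (sign k) (M zero k) (sign j′) (sign l) (M (suc j′) (punchIn k l)) Δ ⟩
        sign j′ * (sign k * sign l) * (M zero k * (M (suc j′) (punchIn k l) * Δ)) ∎
        where Δ = det R (minor j′ l (minor zero k M))

  doubleTerm-antisym : ∀ {n} (M : Matrix R (suc (suc n))) j′ → (∀ b → M zero b ≈ M (suc j′) b) →
    ∀ c l → doubleTerm M j′ c (punchIn c l) ≈ - doubleTerm M j′ (punchIn c l) c
  doubleTerm-antisym M j′ rows≈ c l rewrite punchOut′-punchIn c l = begin
    sign j′ * (sign c * sign l) * (M zero c * (M (suc j′) (punchIn c l) * Δ))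
      ≈⟨ *-congˡ (*-cong (rows≈ c) (*-congʳ (sym (rows≈ (punchIn c l))))) ⟩
    sign j′ * (sign c * sign l) * (M (suc j′) c * (M zero (punchIn c l) * Δ))
      ≈⟨ solve 6 (λ sj sc sl A B Δ → sj :* (sc :* sl) :* (A :* (B :* Δ)) := :- (sj :* (:- (sc :* sl)) :* (B :* (A :* Δ))))
                 refl (sign j′) (sign c) (sign l) (M (suc j′) c) (M zero (punchIn c l)) Δ ⟩
    - (sign j′ * - (sign c * sign l) * (M zero (punchIn c l) * (M (suc j′) c * Δ)))
      ≈⟨ -‿cong (*-cong (*-congˡ (sign-punchIn-punchOut′ c l))
                        (*-congˡ (*-congˡ (det-cong (doubleMinor-swap M j′ c l))))) ⟨
    - doubleTerm M j′ (punchIn c l) c ∎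
    where Δ = det R (minor zero l (minor (suc j′) c M))

  det-equalRows₀ : ∀ {n} (M : Matrix R (suc (suc n))) j′ → (∀ b → M zero b ≈ M (suc j′) b) → det R M ≈ 0#
  det-equalRows₀ M j′ rows≈ = begin
    det R M                                                   ≈⟨ det-expand-twice M j′ ⟩
    sum₂ (λ k l → doubleTerm M j′ k (punchIn k l))          ≈⟨ sum-punchIn≈offDiagonalSum (doubleTerm M j′) ⟩
    offDiagonalSum (doubleTerm M j′)                          ≈⟨ offDiagonalSum-antisym (doubleTerm M j′) antisym ⟩
    0#                                                        ∎
    where
    antisym : ∀ k c → k ≢ c → doubleTerm M j′ c k ≈ - doubleTerm M j′ k c
    antisym k c k≢c = ≡.subst (λ k → doubleTerm M j′ c k ≈ - doubleTerm M j′ k c)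
      (Fin.punchIn-punchOut (k≢c ∘ ≡.sym)) (doubleTerm-antisym M j′ rows≈ c (punchOut (k≢c ∘ ≡.sym)))

  det-equalRows : ∀ {n} (M : Matrix R n) i j → i ≢ j → (∀ b → M i b ≈ M j b) → det R M ≈ 0#
  det-equalRows M zero     zero     i≢j rows≈ = ⊥-elim (i≢j ≡.refl)
  det-equalRows {suc (suc n)} M zero     (suc j′) i≢j rows≈ = det-equalRows₀ M j′ rows≈
  det-equalRows {suc (suc n)} M (suc i′) zero     i≢j rows≈ = det-equalRows₀ M i′ (sym ∘ rows≈)
  det-equalRows {suc (suc n)} M (suc i′) (suc j′) i≢j rows≈ = sum-0 (λ k → begin
    sign k * (M zero k * det R (minor zero k M))
      ≈⟨ *-congˡ (*-congˡ (det-equalRows (minor zero k M) i′ j′ (i≢j ∘ ≡.cong suc) (rows≈ ∘ punchIn k))) ⟩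
    sign k * (M zero k * 0#) ≈⟨ trans (*-congˡ (zeroʳ _)) (zeroʳ _) ⟩
    0#                       ∎)

  adjugate : ∀ {n} → Matrix R n → Matrix R n
  adjugate {suc n} M k j = sgn R (toℕ j ℕ.+ toℕ k) * det R (minor j k M)

  *-adjugate : ∀ {n} (M : Matrix R n) → M *ᴹ adjugate M ≋ (λ i j → det R M * idM R i j)
  *-adjugate {suc n} M i j = begin
    sum (λ k → M i k * adjugate M k j)  ≈⟨ sum-cong-≋ (λ k → sym (replaced k)) ⟩
    sum (laplaceTerm M′ j)              ≈⟨ det-laplace M′ j ⟨
    det R M′                            ≈⟨ det-replaced ⟩
    det R M * idM R i j                 ∎
    where
    M′ : Matrix R (suc n)
    M′ a b = if ⌊ a Fin.≟ j ⌋ then M i b else M a b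
    replaced : ∀ k → laplaceTerm M′ j k ≈ M i k * adjugate M k j
    replaced k = begin
      sgn R (toℕ j ℕ.+ toℕ k) * (M′ j k * det R (minor j k M′))
        ≈⟨ *-congˡ (*-cong (reflexive (if-yes (j Fin.≟ j) ≡.refl))
                           (det-cong (λ a b → reflexive (if-no (punchIn j a Fin.≟ j) (Fin.punchInᵢ≢i j a))))) ⟩
      sgn R (toℕ j ℕ.+ toℕ k) * (M i k * det R (minor j k M))
        ≈⟨ solve 3 (λ s x y → s :* (x :* y) := x :* (s :* y)) refl _ (M i k) _ ⟩
      M i k * adjugate M k j ∎
    det-replaced : det R M′ ≈ det R M * idM R i j
    det-replaced with i Fin.≟ j
    ... | yes ≡.refl = trans (det-cong M′≋M) (sym (*-identityʳ _))
      where
      M′≋M : M′ ≋ M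
      M′≋M a b with a Fin.≟ i
      ... | yes ≡.refl = refl
      ... | no _       = refl
    ... | no i≢j = trans (det-equalRows M′ i j i≢j rows≈) (sym (zeroʳ _))
      where
      rows≈ : ∀ b → M′ i b ≈ M′ j b
      rows≈ b = trans (reflexive (if-no (i Fin.≟ j) i≢j)) (sym (reflexive (if-yes (j Fin.≟ j) ≡.refl)))

  det-invertible⇒rightInverse : ∀ {n} (M : Matrix R n) → Invertible R (det R M) → Σ (Matrix R n) (λ E → M *ᴹ E ≋ 1ᴹ)
  det-invertible⇒rightInverse M (d , det·d≈1) = (λ k j → adjugate M k j * d) , λ i j → begin
    sum (λ k → M i k * (adjugate M k j * d))  ≈⟨ sum-cong-≋ (λ k → *-assoc (M i k) (adjugate M k j) d) ⟨
    sum (λ k → M i k * adjugate M k j * d)    ≈⟨ *-distribʳ-sum d (λ k → M i k * adjugate M k j) ⟨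
    (M *ᴹ adjugate M) i j * d                 ≈⟨ *-congʳ (*-adjugate M i j) ⟩
    det R M * idM R i j * d                   ≈⟨ solve 3 (λ x y z → x :* y :* z := y :* (x :* z)) refl _ _ d ⟩
    idM R i j * (det R M * d)                 ≈⟨ *-congˡ det·d≈1 ⟩
    idM R i j * 1#                            ≈⟨ *-identityʳ _ ⟩
    1ᴹ i j                                    ∎

module TreePaths {n : ℕ} {adj : Fin n → Fin n → Bool} (t : IsTree adj) where
  open IsTree t

  infix 5 _⇝_
  _⇝_ : Fin n → Fin n → List (Fin n)
  i ⇝ j = path adj t i j

  ⇝-isPath : ∀ i j → IsPath adj i j (i ⇝ j)
  ⇝-isPath i j = proj₂ (connected i j)

  ⇝-unique : ∀ {i j ps} → IsPath adj i j ps → i ⇝ j ≡ ps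
  ⇝-unique {i} {j} {ps} = pathUnique i j (i ⇝ j) ps (⇝-isPath i j)

  adj-sym : ∀ {i j} → Adj adj i j → Adj adj j i
  adj-sym {i} {j} = ≡.subst T (symmetric i j)

  adj-irrefl : ∀ {i} → ¬ Adj adj i i
  adj-irrefl {i} = ≡.subst T (irreflexive i)

  adj⇒≢ : ∀ {i j} → Adj adj i j → i ≢ j
  adj⇒≢ i~j ≡.refl = adj-irrefl i~j

  walk-head : ∀ {i j x xs} → IsWalk adj i j (x ∷ xs) → i ≡ x
  walk-head here       = ≡.refl
  walk-head (step _ _) = ≡.refl

  walk-singleton : ∀ {i j x} → IsWalk adj i j (x ∷ []) → i ≡ j
  walk-singleton here = ≡.refl
  walk-singleton (step _ ())

  ⇝-head : ∀ i j → ∃ λ rest → i ⇝ j ≡ i ∷ rest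
  ⇝-head i j with i ⇝ j | ⇝-isPath i j
  ... | x ∷ rest | (w , _) = rest , ≡.cong (_∷ rest) (≡.sym (walk-head w))

  ⇝-refl : ∀ i → i ⇝ i ≡ i ∷ []
  ⇝-refl i = ⇝-unique (here , [] ∷ [])

  ⇝-adj : ∀ {i j} → Adj adj i j → i ⇝ j ≡ i ∷ j ∷ []
  ⇝-adj i~j = ⇝-unique (step i~j here , (adj⇒≢ i~j ∷ []) ∷ [] ∷ [])

  ⇝-tail : ∀ {i j y rest} → i ⇝ j ≡ i ∷ y ∷ rest → Adj adj i y × y ⇝ j ≡ y ∷ rest
  ⇝-tail {i} {j} e with ⇝-isPath i j
  ... | (w , u) with ≡.subst (IsWalk adj i j) e w | ≡.subst Unique e u
  ...   | step i~y w′ | _ ∷ u′ with walk-head w′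
  ...     | ≡.refl = i~y , ⇝-unique (w′ , u′)

  walk-suffix : ∀ {i j ps x} → IsWalk adj i j ps → Unique ps → x ∈ ps →
    ∃ λ qs → IsPath adj x j qs × (∀ {y} → y ∈ qs → y ∈ ps)
  walk-suffix here         u       (here ≡.refl) = _ , (here , u) , λ y∈ → y∈
  walk-suffix (step i~k w) u       (here ≡.refl) = _ , (step i~k w , u) , λ y∈ → y∈
  walk-suffix (step _ w)   (_ ∷ u) (there x∈)    with walk-suffix w u x∈
  ... | qs , isPath , qs⊆ = qs , isPath , there ∘ qs⊆

  ⇝-step : ∀ {k k′} j → Adj adj k k′ → k ⇝ j ≡ k ∷ (k′ ⇝ j) ⊎ k′ ⇝ j ≡ k′ ∷ (k ⇝ j)
  ⇝-step {k} {k′} j k~k′ with ⇝-isPath k′ j | any? (k Fin.≟_) (k′ ⇝ j)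
  ... | (w , u) | no k∉ = inj₁ (⇝-unique (step k~k′ w , ¬Any⇒All¬ _ k∉ ∷ u))
  ... | (w , u) | yes k∈ with ⇝-head k′ j
  ...   | rest , e = inj₂ (via (≡.subst (IsWalk adj k′ j) e w) (≡.subst Unique e u) (≡.subst (k ∈_) e k∈))
    where
    via : IsWalk adj k′ j (k′ ∷ rest) → Unique (k′ ∷ rest) → k ∈ k′ ∷ rest → k′ ⇝ j ≡ k′ ∷ (k ⇝ j)
    via _            _               (here k≡k′)  = ⊥-elim (adj⇒≢ k~k′ k≡k′)
    via (step _ w′)  (k′∉rest ∷ u′)  (there k∈rest) with walk-suffix w′ u′ k∈rest
    ... | qs , k⇝j , qs⊆rest = ≡.trans
      (⇝-unique (step (adj-sym k~k′) (proj₁ k⇝j) , ¬Any⇒All¬ qs (All¬⇒¬Any k′∉rest ∘ qs⊆rest) ∷ proj₂ k⇝j))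
      (≡.cong (k′ ∷_) (≡.sym (⇝-unique k⇝j)))

  ⇝-step-exclusive : ∀ {k k′ j} → k ⇝ j ≡ k ∷ (k′ ⇝ j) → k′ ⇝ j ≡ k′ ∷ (k ⇝ j) → ⊥
  ⇝-step-exclusive {k} {k′} {j} e e′ =
    ℕ.m≢1+n+m (length (k ⇝ j)) {1} (≡.trans (≡.cong length e) (≡.cong (suc ∘ length) e′))

  secondIs : List (Fin n) → Fin n → Bool
  secondIs []          _ = false
  secondIs (_ ∷ [])    _ = false
  secondIs (_ ∷ y ∷ _) z = ⌊ y Fin.≟ z ⌋

  towards : Fin n → Fin n → Fin n → Bool
  towards k k′ j = secondIs (k ⇝ j) k′

  towards⇒step : ∀ {k k′ j} → towards k k′ j ≡ true → Adj adj k k′ × k ⇝ j ≡ k ∷ (k′ ⇝ j)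
  towards⇒step {k} {k′} {j} h with ⇝-head k j
  ... | rest , e with rest | e | ≡.subst (λ ps → secondIs ps k′ ≡ true) e h
  ...   | y ∷ _ | e′ | y≟k′ with ⌊⌋-true (y Fin.≟ k′) y≟k′
  ...     | ≡.refl = proj₁ (⇝-tail e′) , ≡.trans e′ (≡.cong (k ∷_) (≡.sym (proj₂ (⇝-tail e′))))

  towards⇒adj : ∀ {k k′ j} → towards k k′ j ≡ true → Adj adj k k′
  towards⇒adj = proj₁ ∘ towards⇒step

  step⇒towards : ∀ {k k′ j} → k ⇝ j ≡ k ∷ (k′ ⇝ j) → towards k k′ j ≡ true
  step⇒towards {k} {k′} {j} e with ⇝-head k′ j
  ... | _ , e′ =
    ≡.trans (≡.cong (λ ps → secondIs ps k′) (≡.trans e (≡.cong (k ∷_) e′))) (⌊⌋-yes (k′ Fin.≟ k′) ≡.refl)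

  towards-antisym : ∀ {k k′ j} → towards k k′ j ≡ true → towards k′ k j ≡ false
  towards-antisym h = Bool.¬-not (⇝-step-exclusive (proj₂ (towards⇒step h)) ∘ proj₂ ∘ towards⇒step)

  towards-orientation : ∀ {k k′} j → Adj adj k k′ →
    (towards k k′ j ≡ true × towards k′ k j ≡ false) ⊎ (towards k k′ j ≡ false × towards k′ k j ≡ true)
  towards-orientation j k~k′ with ⇝-step j k~k′
  ... | inj₁ e = inj₁ (step⇒towards e , towards-antisym (step⇒towards e))
  ... | inj₂ e = inj₂ (towards-antisym (step⇒towards e) , step⇒towards e)

  ¬adj⇒¬towards : ∀ {k k′} j → ¬ Adj adj k k′ → towards k k′ j ≡ false
  ¬adj⇒¬towards j ¬k~k′ = Bool.¬-not (¬k~k′ ∘ towards⇒adj)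

  towards-target : ∀ j k′ → towards j k′ j ≡ false
  towards-target j k′ rewrite ⇝-refl j = ≡.refl

  towards-next : ∀ {k j} → k ≢ j → ∃ λ y → towards k y j ≡ true × (∀ z → towards k z j ≡ true → z ≡ y)
  towards-next {k} {j} k≢j with ⇝-head k j
  ... | rest , e with rest | e
  ...   | [] | e′ = ⊥-elim (k≢j (walk-singleton (≡.subst (IsWalk adj k j) e′ (proj₁ (⇝-isPath k j)))))
  ...   | y ∷ _ | e′ = y , ≡.trans (≡.cong (λ ps → secondIs ps y) e′) (⌊⌋-yes (y Fin.≟ y) ≡.refl) , unique
    where
    unique : ∀ z → towards k z j ≡ true → z ≡ y
    unique z h = ≡.sym (⌊⌋-true (y Fin.≟ z) (≡.trans (≡.cong (λ ps → secondIs ps z) (≡.sym e′)) h))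

  walk-snoc : ∀ {i j k ps} → IsWalk adj i j ps → Adj adj j k → IsWalk adj i k (ps ++ k ∷ [])
  walk-snoc here       j~k = step j~k here
  walk-snoc (step i~y w) j~k = step i~y (walk-snoc w j~k)

  walk-reverse : ∀ {i j ps} → IsWalk adj i j ps → IsWalk adj j i (reverse ps)
  walk-reverse here = here
  walk-reverse {i} (step {ps = ps} i~y w) =
    ≡.subst (IsWalk adj _ i) (≡.sym (List.unfold-reverse i ps)) (walk-snoc (walk-reverse w) (adj-sym i~y))

  ⇝-reverse : ∀ i j → i ⇝ j ≡ reverse (j ⇝ i)
  ⇝-reverse i j = ⇝-unique (walk-reverse (proj₁ (⇝-isPath j i)) , Unique-reverse (proj₂ (⇝-isPath j i)))

  ∈-⇝-sym : ∀ {x i j} → x ∈ i ⇝ j → x ∈ j ⇝ i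
  ∈-⇝-sym {x} {i} {j} x∈ = reverse⁻ (≡.subst (x ∈_) (⇝-reverse i j) x∈)

  ⇝-nonempty : ∀ i j → i ⇝ j ≢ []
  ⇝-nonempty i j e with ⇝-head i j
  ... | _ , e′ with () ← ≡.trans (≡.sym e) e′

  ⇝-start : ∀ {i j x rest} → i ⇝ j ≡ x ∷ rest → i ≡ x
  ⇝-start {i} {j} e = List.∷-injectiveˡ (≡.trans (≡.sym (proj₂ (⇝-head i j))) e)

  any-≟⇒∈ : ∀ {l} (ps : List (Fin n)) → any (λ x → ⌊ x Fin.≟ l ⌋) ps ≡ true → l ∈ ps
  any-≟⇒∈ ps h = Any.map (λ x≟l → ≡.sym (toWitness x≟l)) (any⁻ _ ps (Equivalence.from Bool.T-≡ h))

  ∈⇒any-≟ : ∀ {l} (ps : List (Fin n)) → l ∈ ps → any (λ x → ⌊ x Fin.≟ l ⌋) ps ≡ true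
  ∈⇒any-≟ ps l∈ = Equivalence.to Bool.T-≡ (any⁺ _ (Any.map (λ l≡x → fromWitness (≡.sym l≡x)) l∈))

  -- TreeObjects.inSub, stated without the ring data: the vertex set of T_{i→l}.
  inSubtree : Fin n → Fin n → Fin n → Bool
  inSubtree i l v = ⌊ v Fin.≟ i ⌋ ∨ any (λ x → ⌊ x Fin.≟ l ⌋) (i ⇝ v)

  inSubtree-root : ∀ i l → inSubtree i l i ≡ true
  inSubtree-root i l rewrite ⌊⌋-yes (i Fin.≟ i) ≡.refl = ≡.refl

  inSubtree⇒∈ : ∀ {i l v} → v ≢ i → inSubtree i l v ≡ true → l ∈ v ⇝ i
  inSubtree⇒∈ {i} {l} {v} v≢i h rewrite ⌊⌋-no (v Fin.≟ i) v≢i = ∈-⇝-sym (any-≟⇒∈ (i ⇝ v) h)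

  ∈⇒inSubtree : ∀ {i l v} → l ∈ v ⇝ i → inSubtree i l v ≡ true
  ∈⇒inSubtree {i} {l} {v} l∈ with v Fin.≟ i
  ... | yes _ = ≡.refl
  ... | no _  = ∈⇒any-≟ (i ⇝ v) (∈-⇝-sym l∈)

  inSubtree-step : ∀ {i l k k′} → Adj adj i l → Adj adj k k′ → k ≢ i → inSubtree i l k ≡ true →
    (k′ ≡ i × k ≡ l) ⊎ (k′ ≢ i × inSubtree i l k′ ≡ true)
  inSubtree-step {i} {l} {k} {k′} i~l k~k′ k≢i k∈T with inSubtree⇒∈ k≢i k∈T | ⇝-step i k~k′
  ... | l∈k⇝i | inj₂ e = inj₂ (k′≢i , ∈⇒inSubtree (≡.subst (l ∈_) (≡.sym e) (there l∈k⇝i)))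
    where
    k′≢i : k′ ≢ i
    k′≢i ≡.refl = ⇝-nonempty k i (List.∷-injectiveʳ (≡.trans (≡.sym e) (⇝-refl i)))
  ... | l∈k⇝i | inj₁ e = viaNext (k′ Fin.≟ i) (≡.subst (l ∈_) e l∈k⇝i)
    where
    viaNext : Dec (k′ ≡ i) → l ∈ k ∷ (k′ ⇝ i) → (k′ ≡ i × k ≡ l) ⊎ (k′ ≢ i × inSubtree i l k′ ≡ true)
    viaNext (yes ≡.refl) (here l≡k) = inj₁ (≡.refl , ≡.sym l≡k)
    viaNext (yes ≡.refl) (there l∈i⇝i) with ≡.subst (l ∈_) (⇝-refl i) l∈i⇝i
    ... | here l≡i = ⊥-elim (adj⇒≢ i~l (≡.sym l≡i))
    viaNext (no k′≢i) (there l∈k′⇝i) = inj₂ (k′≢i , ∈⇒inSubtree l∈k′⇝i)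
    viaNext (no k′≢i) (here ≡.refl) =
      ⊥-elim (k′≢i (⇝-start (List.∷-injectiveʳ (≡.trans (≡.sym e) (⇝-adj (adj-sym i~l))))))

  strictSubtree : Fin n → Fin n → Fin n → Bool
  strictSubtree i l k = not ⌊ k Fin.≟ i ⌋ ∧ inSubtree i l k

  strictSubtree-true : ∀ {i l k} → strictSubtree i l k ≡ true → k ≢ i × inSubtree i l k ≡ true
  strictSubtree-true {i} {l} {k} h with k Fin.≟ i
  ... | no k≢i = k≢i , h

  strictSubtree-false : ∀ {i l k} → strictSubtree i l k ≡ false → k ≡ i ⊎ inSubtree i l k ≡ false
  strictSubtree-false {i} {l} {k} h with k Fin.≟ i
  ... | yes k≡i = inj₁ k≡i
  ... | no _    = inj₂ h

  strictSubtree-root : ∀ i l → strictSubtree i l i ≡ false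
  strictSubtree-root i l rewrite ⌊⌋-yes (i Fin.≟ i) ≡.refl = ≡.refl

  strictSubtree-≢ : ∀ {i l k} → k ≢ i → strictSubtree i l k ≡ inSubtree i l k
  strictSubtree-≢ {i} {l} {k} k≢i = ≡.cong (λ b → not b ∧ inSubtree i l k) (⌊⌋-no (k Fin.≟ i) k≢i)

  strictSubtree-intro : ∀ {i l k} → k ≢ i → inSubtree i l k ≡ true → strictSubtree i l k ≡ true
  strictSubtree-intro k≢i = ≡.trans (strictSubtree-≢ k≢i)

  strictSubtree-neighbour : ∀ {i l} → Adj adj i l → strictSubtree i l l ≡ true
  strictSubtree-neighbour {i} {l} i~l = strictSubtree-intro (adj⇒≢ i~l ∘ ≡.sym)
    (∈⇒inSubtree (≡.subst (l ∈_) (≡.sym (proj₂ (⇝-head l i))) (here ≡.refl)))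

module TreeSums {c ℓ} (R : CommutativeRing c ℓ) {n : ℕ} {adj : Fin n → Fin n → Bool} (t : IsTree adj) where
  open CommutativeRing R hiding (zero)
  open RingLemmas R using (if-true; if-false)
  open Sums R
  open TreePaths t
  open import Relation.Binary.Reasoning.Setoid setoid

  sum-towards-target : ∀ j x → sum (λ k′ → if towards j k′ j then x else 0#) ≈ 0#
  sum-towards-target j x = sum-0 (λ k′ → if-false (towards-target j k′))

  sum-towards : ∀ {k j} → k ≢ j → ∀ x → sum (λ k′ → if towards k k′ j then x else 0#) ≈ x
  sum-towards {k} {j} k≢j x with towards-next k≢j
  ... | y , towards-y , unique = trans (sum-concentrated _ y off-y) (if-true towards-y)
    where
    off-y : ∀ k′ → k′ ≢ y → (if towards k k′ j then x else 0#) ≈ 0#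
    off-y k′ k′≢y with towards k k′ j in e
    ... | true  = ⊥-elim (k′≢y (unique k′ e))
    ... | false = refl

  sum-byNextVertex : ∀ j (h : Fin n → Carrier) →
    sum h ≈ h j + sum₂ (λ k k′ → if towards k k′ j then h k else 0#)
  sum-byNextVertex j h = begin
    sum h
      ≈⟨ sum-cong-≋ split ⟩
    sum (λ k → atRoot k + sum (λ k′ → if towards k k′ j then h k else 0#))
      ≈⟨ ∑-distrib-+ atRoot _ ⟩
    sum atRoot + sum₂ (λ k k′ → if towards k k′ j then h k else 0#)
      ≈⟨ +-congʳ (sum-concentrated atRoot j (λ k k≢j → reflexive (if-no (k Fin.≟ j) k≢j))) ⟩
    atRoot j + sum₂ (λ k k′ → if towards k k′ j then h k else 0#)
      ≈⟨ +-congʳ (reflexive (if-yes (j Fin.≟ j) ≡.refl)) ⟩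
    h j + sum₂ (λ k k′ → if towards k k′ j then h k else 0#) ∎
    where
    atRoot : Fin n → Carrier
    atRoot k = if ⌊ k Fin.≟ j ⌋ then h k else 0#
    split : ∀ k → h k ≈ atRoot k + sum (λ k′ → if towards k k′ j then h k else 0#)
    split k with k Fin.≟ j
    ... | yes ≡.refl = sym (trans (+-congˡ (sum-towards-target k (h k))) (+-identityʳ _))
    ... | no k≢j     = sym (trans (+-identityˡ _) (sum-towards k≢j (h k)))

  sum-byOrientedEdge : ∀ j (g : Fin n → Fin n → Carrier) → (∀ k k′ → ¬ Adj adj k k′ → g k k′ ≈ 0#) →
    sum₂ g ≈ sum₂ (λ k k′ → if towards k k′ j then g k k′ + g k′ k else 0#)
  sum-byOrientedEdge j g g≈0 = begin
    sum₂ g                                     ≈⟨ sum₂-cong split ⟩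
    sum₂ (λ k k′ → fwd k k′ + bwd k k′)        ≈⟨ sum₂-distrib-+ fwd bwd ⟩
    sum₂ fwd + sum₂ bwd                        ≈⟨ +-congˡ (∑-comm bwd) ⟩
    sum₂ fwd + sum₂ (λ k k′ → bwd k′ k)        ≈⟨ sum₂-distrib-+ fwd (λ k k′ → bwd k′ k) ⟨
    sum₂ (λ k k′ → fwd k k′ + bwd k′ k)        ≈⟨ sum₂-cong merge ⟩
    sum₂ (λ k k′ → if towards k k′ j then g k k′ + g k′ k else 0#) ∎
    where
    fwd bwd : Fin n → Fin n → Carrier
    fwd k k′ = if towards k k′ j then g k k′ else 0#
    bwd k k′ = if towards k′ k j then g k k′ else 0#
    split : ∀ k k′ → g k k′ ≈ fwd k k′ + bwd k k′
    split k k′ with Bool.T? (adj k k′)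
    ... | no ¬k~k′ = begin
      g k k′                 ≈⟨ g≈0 k k′ ¬k~k′ ⟩
      0#                     ≈⟨ +-identityʳ 0# ⟨
      0# + 0#
        ≈⟨ +-cong (if-false (¬adj⇒¬towards j ¬k~k′)) (if-false (¬adj⇒¬towards j (¬k~k′ ∘ adj-sym))) ⟨
      fwd k k′ + bwd k k′    ∎
    ... | yes k~k′ with towards-orientation j k~k′
    ...   | inj₁ (to , ¬from) = sym (trans (+-cong (if-true to) (if-false (towards-antisym to))) (+-identityʳ _))
    ...   | inj₂ (¬to , from) = sym (trans (+-cong (if-false ¬to) (if-true from)) (+-identityˡ _))
    merge : ∀ k k′ → fwd k k′ + bwd k′ k ≈ (if towards k k′ j then g k k′ + g k′ k else 0#)
    merge k k′ with towards k k′ j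
    ... | true  = refl
    ... | false = +-identityʳ 0#

module InverseFormula {c ℓ} (R : CommutativeRing c ℓ) {n : ℕ}
  (adj : Fin n → Fin n → Bool) (t : IsTree adj) (a m : Matrix R n)
  (a-sym : ∀ i j → Adj adj i j → CommutativeRing._≈_ R (a i j) (a j i))
  (aInv : ∀ i j → Adj adj i j → Invertible R (a i j))
  (qInv : ∀ i j → Adj adj i j →
            Invertible R (CommutativeRing._-_ R (CommutativeRing._*_ R (m i j) (m j i)) (CommutativeRing.1# R)))
  where
  open CommutativeRing R hiding (zero)
  open RingLemmas R
  open Sums R
  open Matrices R
  open Determinant R using (det-invertible⇒rightInverse)
  open TreePaths t
  open TreeSums R t
  open TreeObjects R adj t a m aInv qInv
  open IntegerRingSolver R using (solve; _:=_; _:+_; _:*_; :-_; _:-_; :0; :1)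
  open import Algebra.Properties.AbelianGroup +-abelianGroup using (ε⁻¹≈ε)
  open import Algebra.Properties.Ring ring using (x[y-z]≈xy-xz; [y-z]x≈yx-zx)
  open import Relation.Binary.Reasoning.Setoid setoid

  a-inverse : ∀ k k′ (p : Adj adj k k′) → a k k′ * ainv k k′ p ≈ 1#
  a-inverse k k′ p = proj₂ (aInv k k′ p)

  q-inverse : ∀ k k′ (p : Adj adj k k′) → (m k k′ * m k′ k - 1#) * qinv k k′ p ≈ 1#
  q-inverse k k′ p = proj₂ (qInv k k′ p)

  qinv-sym : ∀ k k′ (p : Adj adj k k′) (p′ : Adj adj k′ k) → qinv k k′ p ≈ qinv k′ k p′
  qinv-sym k k′ p p′ = inverse-unique (+-congʳ (*-comm _ _)) (q-inverse k k′ p) (q-inverse k′ k p′)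

  τinTerm : Fin n → Fin n → Carrier
  τinTerm k k′ = when R (adj k k′) (λ p → m k′ k * (m k k′ - 1#) * qinv k k′ p)

  edgeWeight : Fin n → Fin n → Carrier
  edgeWeight u w = when R (adj u w) (edgeTerm u w)

  τinTerm-adj : ∀ k k′ (p : Adj adj k k′) → τinTerm k k′ ≈ m k′ k * (m k k′ - 1#) * qinv k k′ p
  τinTerm-adj k k′ = when-yes _

  τinTerm-adj′ : ∀ k k′ (p : Adj adj k k′) → τinTerm k′ k ≈ m k k′ * (m k′ k - 1#) * qinv k k′ p
  τinTerm-adj′ k k′ p = trans (τinTerm-adj k′ k (adj-sym p)) (*-congˡ (qinv-sym k′ k (adj-sym p) p))

  edgeWeight-adj : ∀ k k′ (p : Adj adj k k′) → edgeWeight k k′ ≈ a k k′ * (m k k′ - 1#) * (m k′ k - 1#) * qinv k k′ p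
  edgeWeight-adj k k′ = when-yes _

  edgeWeight-sym : ∀ u w → edgeWeight u w ≈ edgeWeight w u
  edgeWeight-sym u w with Bool.T? (adj u w)
  ... | no ¬u~w = trans (when-no _ ¬u~w) (sym (when-no _ (¬u~w ∘ adj-sym)))
  ... | yes u~w = begin
    edgeWeight u w
      ≈⟨ edgeWeight-adj u w u~w ⟩
    a u w * (m u w - 1#) * (m w u - 1#) * qinv u w u~w
      ≈⟨ *-cong (*-congʳ (*-congʳ (a-sym u w u~w))) (qinv-sym u w u~w (adj-sym u~w)) ⟩
    a w u * (m u w - 1#) * (m w u - 1#) * qinv w u (adj-sym u~w)
      ≈⟨ *-congʳ (solve 3 (λ A x y → A :* x :* y := A :* y :* x) refl _ _ _) ⟩
    a w u * (m w u - 1#) * (m u w - 1#) * qinv w u (adj-sym u~w)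
      ≈⟨ edgeWeight-adj w u (adj-sym u~w) ⟨
    edgeWeight w u ∎

  flux : (Fin n → Bool) → (Fin n → Carrier) → Fin n → Fin n → Carrier
  flux S f k k′ = (if S k then (1# - τinTerm k k′) * f k else 0#) - (if S k′ then τinTerm k′ k * f k′ else 0#)

  τin-byOrientedEdge : ∀ j (S : Fin n → Bool) (f : Fin n → Carrier) →
    sum (λ k → if S k then τin k * f k else 0#)
      ≈ (if S j then f j else 0#) + sum₂ (λ k k′ → if towards k k′ j then flux S f k k′ else 0#)
  τin-byOrientedEdge j S f = begin
    sum (λ k → if S k then τin k * f k else 0#)
      ≈⟨ sum-cong-≋ expand ⟩
    sum (λ k → Sf k - sum (out k))
      ≈⟨ ∑-distrib-- Sf (λ k → sum (out k)) ⟩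
    sum Sf - sum₂ out
      ≈⟨ +-cong (sum-byNextVertex j Sf) (-‿cong (sum-byOrientedEdge j out out≈0)) ⟩
    (Sf j + sum₂ fromVertex) - sum₂ alongEdge
      ≈⟨ +-assoc _ _ _ ⟩
    Sf j + (sum₂ fromVertex - sum₂ alongEdge)
      ≈⟨ +-congˡ (sum₂-distrib-- fromVertex alongEdge) ⟨
    Sf j + sum₂ (λ k k′ → fromVertex k k′ - alongEdge k k′)
      ≈⟨ +-congˡ (sum₂-cong combine) ⟩
    Sf j + sum₂ (λ k k′ → if towards k k′ j then flux S f k k′ else 0#) ∎
    where
    Sf : Fin n → Carrier
    Sf k = if S k then f k else 0#
    out fromVertex alongEdge : Fin n → Fin n → Carrier
    out k k′ = if S k then τinTerm k k′ * f k else 0#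
    fromVertex k k′ = if towards k k′ j then Sf k else 0#
    alongEdge k k′ = if towards k k′ j then out k k′ + out k′ k else 0#
    expand : ∀ k → (if S k then τin k * f k else 0#) ≈ Sf k - sum (out k)
    expand k with S k
    ... | true = begin
      (1# - sum (τinTerm k)) * f k                ≈⟨ [y-z]x≈yx-zx (f k) 1# (sum (τinTerm k)) ⟩
      1# * f k - sum (τinTerm k) * f k            ≈⟨ +-cong (*-identityˡ _) (-‿cong (*-distribʳ-sum (f k) (τinTerm k))) ⟩
      f k - sum (λ k′ → τinTerm k k′ * f k)       ∎
    ... | false = sym (trans (+-congˡ (trans (-‿cong (sum-0 {n} {λ _ → 0#} (λ _ → refl))) ε⁻¹≈ε)) (+-identityʳ 0#))
    out≈0 : ∀ k k′ → ¬ Adj adj k k′ → out k k′ ≈ 0#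
    out≈0 k k′ ¬k~k′ with S k
    ... | true  = trans (*-congʳ (when-no _ ¬k~k′)) (zeroˡ _)
    ... | false = refl
    combine : ∀ k k′ → fromVertex k k′ - alongEdge k k′ ≈ (if towards k k′ j then flux S f k k′ else 0#)
    combine k k′ with towards k k′ j
    ... | false = -‿inverseʳ 0#
    ... | true with S k | S k′
    ...   | true  | true  = solve 4 (λ x c c′ x′ → x :- (c :* x :+ c′ :* x′) := (:1 :- c) :* x :- c′ :* x′) refl _ _ _ _
    ...   | true  | false = solve 2 (λ x c → x :- (c :* x :+ :0) := (:1 :- c) :* x :- :0) refl _ _
    ...   | false | true  = solve 2 (λ c′ x′ → :0 :- (:0 :+ c′ :* x′) := :0 :- c′ :* x′) refl _ _
    ...   | false | false = solve 0 (:0 :- (:0 :+ :0) := :0 :- :0) refl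

  D-self : ∀ j → D j j ≈ 0#
  D-self j = reflexive (≡.cong pathSum (⇝-refl j))

  D-step : ∀ {k k′ j} → k ⇝ j ≡ k ∷ (k′ ⇝ j) → D k j ≈ a k k′ * (m k k′ - 1#) + m k k′ * D k′ j
  D-step {k} {k′} {j} e with ⇝-head k′ j
  ... | _ , e′ = reflexive (≡.trans (≡.cong pathSum (≡.trans e (≡.cong (k ∷_) e′)))
                                    (≡.cong (λ ps → a k k′ * (m k k′ - 1#) + m k k′ * pathSum ps) (≡.sym e′)))

  D-edge : ∀ {k k′ j} → towards k k′ j ≡ true → (1# - τinTerm k k′) * D k j - τinTerm k′ k * D k′ j ≈ edgeWeight k k′
  D-edge {k} {k′} {j} h with towards⇒step h
  ... | p , e = begin
    (1# - τinTerm k k′) * D k j - τinTerm k′ k * D k′ j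
      ≈⟨ +-cong (*-cong (+-congˡ (-‿cong (τinTerm-adj k k′ p))) (D-step e)) (-‿cong (*-congʳ (τinTerm-adj′ k k′ p))) ⟩
    (1# - y * (x - 1#) * q) * (A * (x - 1#) + x * Δ) - x * (y - 1#) * q * Δ
      ≈⟨ solve 5 (λ A x y q Δ → (:1 :- y :* (x :- :1) :* q) :* (A :* (x :- :1) :+ x :* Δ) :- x :* (y :- :1) :* q :* Δ
                             := A :* (x :- :1) :* (y :- :1) :* q :+ (:- (A :* (x :- :1) :+ x :* Δ)) :* ((x :* y :- :1) :* q :- :1))
                 refl A x y q Δ ⟩
    A * (x - 1#) * (y - 1#) * q + (- (A * (x - 1#) + x * Δ)) * ((x * y - 1#) * q - 1#)
      ≈⟨ +-congˡ (*-[u-1]≈0 _ (q-inverse k k′ p)) ⟩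
    A * (x - 1#) * (y - 1#) * q + 0#
      ≈⟨ trans (+-identityʳ _) (sym (edgeWeight-adj k k′ p)) ⟩
    edgeWeight k k′ ∎
    where
    A = a k k′
    x = m k k′
    y = m k′ k
    q = qinv k k′ p
    Δ = D k′ j

  edgeSum-byOrientedEdge : ∀ j (P : Fin n → Fin n → Bool) → (∀ u w → P u w ≡ P w u) →
    edgeSum P ≈ sum₂ (λ u w → if towards u w j then (if P u w then edgeWeight u w else 0#) else 0#)
  edgeSum-byOrientedEdge j P P-sym = begin
    edgeSum P
      ≈⟨ sum₂-cong (λ u w → when-if (adj u w) (⌊ u Fin.<? w ⌋ ∧ P u w) (edgeTerm u w)) ⟩
    sum₂ ordered
      ≈⟨ sum-byOrientedEdge j ordered ordered≈0 ⟩
    sum₂ (λ u w → if towards u w j then ordered u w + ordered w u else 0#)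
      ≈⟨ sum₂-cong unorder ⟩
    sum₂ (λ u w → if towards u w j then guarded u w else 0#) ∎
    where
    guarded ordered : Fin n → Fin n → Carrier
    guarded u w = if P u w then edgeWeight u w else 0#
    ordered u w = if ⌊ u Fin.<? w ⌋ ∧ P u w then edgeWeight u w else 0#
    ordered≈0 : ∀ u w → ¬ Adj adj u w → ordered u w ≈ 0#
    ordered≈0 u w ¬u~w with ⌊ u Fin.<? w ⌋ ∧ P u w
    ... | true  = when-no _ ¬u~w
    ... | false = refl
    ordered-< : ∀ {u w} → u Fin.< w → ordered u w ≈ guarded u w
    ordered-< {u} {w} u<w = reflexive (≡.cong (λ b → if b ∧ P u w then edgeWeight u w else 0#) (⌊⌋-yes (u Fin.<? w) u<w))
    ordered-≮ : ∀ {u w} → ¬ u Fin.< w → ordered u w ≈ 0#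
    ordered-≮ {u} {w} u≮w = reflexive (≡.cong (λ b → if b ∧ P u w then edgeWeight u w else 0#) (⌊⌋-no (u Fin.<? w) u≮w))
    guarded-sym : ∀ u w → guarded w u ≈ guarded u w
    guarded-sym u w rewrite P-sym w u with P u w
    ... | true  = edgeWeight-sym w u
    ... | false = refl
    unorder : ∀ u w → (if towards u w j then ordered u w + ordered w u else 0#)
                      ≈ (if towards u w j then guarded u w else 0#)
    unorder u w with towards u w j in e
    ... | false = refl
    ... | true with Fin.<-cmp u w
    ...   | tri< u<w _ w≮u = trans (+-cong (ordered-< u<w) (ordered-≮ w≮u)) (+-identityʳ _)
    ...   | tri≈ _ u≡w _   = ⊥-elim (adj⇒≢ (towards⇒adj e) u≡w)
    ...   | tri> u≮w _ w<u = trans (+-cong (ordered-≮ u≮w) (ordered-< w<u)) (trans (+-identityˡ _) (guarded-sym u w))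

  τinᵀD≈α : ∀ j → sum (λ k → τin k * D k j) ≈ α
  τinᵀD≈α j = begin
    sum (λ k → τin k * D k j)
      ≈⟨ τin-byOrientedEdge j (λ _ → true) (λ v → D v j) ⟩
    D j j + sum₂ (λ k k′ → if towards k k′ j then flux (λ _ → true) (λ v → D v j) k k′ else 0#)
      ≈⟨ +-cong (D-self j) (sum₂-cong edge) ⟩
    0# + sum₂ (λ u w → if towards u w j then edgeWeight u w else 0#)
      ≈⟨ +-identityˡ _ ⟩
    sum₂ (λ u w → if towards u w j then edgeWeight u w else 0#)
      ≈⟨ edgeSum-byOrientedEdge j (λ _ _ → true) (λ _ _ → ≡.refl) ⟨
    α ∎
    where
    edge : ∀ k k′ → (if towards k k′ j then flux (λ _ → true) (λ v → D v j) k k′ else 0#)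
                    ≈ (if towards k k′ j then edgeWeight k k′ else 0#)
    edge k k′ with towards k k′ j in e
    ... | true  = D-edge e
    ... | false = refl

  pathProduct : List (Fin n) → Carrier
  pathProduct []           = 1#
  pathProduct (_ ∷ [])     = 1#
  pathProduct (x ∷ y ∷ ps) = m x y * pathProduct (y ∷ ps)

  ζ : Fin n → Fin n → Carrier
  ζ r k = pathProduct (k ⇝ r)

  ζ-step : ∀ {k k′ r} → k ⇝ r ≡ k ∷ (k′ ⇝ r) → ζ r k ≈ m k k′ * ζ r k′
  ζ-step {k} {k′} {r} e with ⇝-head k′ r
  ... | _ , e′ = reflexive (≡.trans (≡.cong pathProduct (≡.trans e (≡.cong (k ∷_) e′)))
                                    (≡.cong (λ ps → m k k′ * pathProduct ps) (≡.sym e′)))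

  ζ-edge : ∀ {k k′ r} → towards k k′ r ≡ true → (1# - τinTerm k k′) * ζ r k - τinTerm k′ k * ζ r k′ ≈ 0#
  ζ-edge {k} {k′} {r} h with towards⇒step h
  ... | p , e = begin
    (1# - τinTerm k k′) * ζ r k - τinTerm k′ k * ζ r k′
      ≈⟨ +-cong (*-cong (+-congˡ (-‿cong (τinTerm-adj k k′ p))) (ζ-step e)) (-‿cong (*-congʳ (τinTerm-adj′ k k′ p))) ⟩
    (1# - y * (x - 1#) * q) * (x * z) - x * (y - 1#) * q * z
      ≈⟨ solve 4 (λ x y q z → (:1 :- y :* (x :- :1) :* q) :* (x :* z) :- x :* (y :- :1) :* q :* z
                            := (:- (x :* z)) :* ((x :* y :- :1) :* q :- :1)) refl x y q z ⟩
    (- (x * z)) * ((x * y - 1#) * q - 1#)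
      ≈⟨ *-[u-1]≈0 _ (q-inverse k k′ p) ⟩
    0# ∎
    where
    x = m k k′
    y = m k′ k
    q = qinv k k′ p
    z = ζ r k′

  τinᵀζ≈1 : ∀ r → sum (λ k → τin k * ζ r k) ≈ 1#
  τinᵀζ≈1 r = begin
    sum (λ k → τin k * ζ r k)
      ≈⟨ τin-byOrientedEdge r (λ _ → true) (ζ r) ⟩
    ζ r r + sum₂ (λ k k′ → if towards k k′ r then flux (λ _ → true) (ζ r) k k′ else 0#)
      ≈⟨ +-cong (reflexive (≡.cong pathProduct (⇝-refl r))) (sum₂-0 edge) ⟩
    1# + 0#
      ≈⟨ +-identityʳ _ ⟩
    1# ∎
    where
    edge : ∀ k k′ → (if towards k k′ r then flux (λ _ → true) (ζ r) k k′ else 0#) ≈ 0#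
    edge k k′ with towards k k′ r in h
    ... | true  = ζ-edge h
    ... | false = refl

  subtreeDefect : Fin n → Fin n → Fin n → Carrier
  subtreeDefect i j l = edgeSum (λ u w → inSubtree i l u ∧ inSubtree i l w)
                        - sum (λ k → if strictSubtree i l k then τin k * D k j else 0#)

  module _ {i l : Fin n} (i~l : Adj adj i l) (j : Fin n) where

    private
      P : Fin n → Fin n → Bool
      P u w = inSubtree i l u ∧ inSubtree i l w

      strict = strictSubtree i l

    towardsRoot towardsLeaf : Carrier
    towardsRoot = if towards l i j then edgeWeight l i - (1# - τinTerm l i) * D l j else 0#
    towardsLeaf = if towards i l j then edgeWeight i l + τinTerm l i * D l j else 0#

    edgeDefect masses : Fin n → Fin n → Carrier
    edgeDefect k k′ = (if P k k′ then edgeWeight k k′ else 0#) - flux strict (λ v → D v j) k k′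
    masses k k′ = pointMass i l towardsLeaf k k′ + pointMass l i towardsRoot k k′

    private
      l≢i : l ≢ i
      l≢i = adj⇒≢ i~l ∘ ≡.sym

      ≢l : ∀ {v} → strict v ≡ false → v ≢ l
      ≢l v∉ ≡.refl with () ← ≡.trans (≡.sym v∉) (strictSubtree-neighbour i~l)

      ≢i : ∀ {v} → strict v ≡ true → v ≢ i
      ≢i {v} v∈ = proj₁ (strictSubtree-true {i} {l} {v} v∈)

      ∈T : ∀ {v} → strict v ≡ true → inSubtree i l v ≡ true
      ∈T {v} v∈ = proj₂ (strictSubtree-true {i} {l} {v} v∈)

    edgeDefect-inside : ∀ {k k′} → towards k k′ j ≡ true → strict k ≡ true → strict k′ ≡ true →
      edgeDefect k k′ ≈ masses k k′
    edgeDefect-inside {k} {k′} h k∈ k′∈ = begin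
      edgeDefect k k′
        ≈⟨ +-cong (if-true (≡.cong₂ _∧_ (∈T {k} k∈) (∈T {k′} k′∈)))
                  (-‿cong (+-cong (if-true k∈) (-‿cong (if-true k′∈)))) ⟩
      edgeWeight k k′ - ((1# - τinTerm k k′) * D k j - τinTerm k′ k * D k′ j)
        ≈⟨ +-congˡ (-‿cong (D-edge h)) ⟩
      edgeWeight k k′ - edgeWeight k k′
        ≈⟨ -‿inverseʳ _ ⟩
      0#
        ≈⟨ +-identityʳ 0# ⟨
      0# + 0#
        ≈⟨ +-cong (pointMass-off i l _ k k′ (inj₁ (≢i k∈)))
                  (pointMass-off l i _ k k′ (inj₂ (≢i k′∈))) ⟨
      masses k k′ ∎

    edgeDefect-outside : ∀ {k k′} → Adj adj k k′ → strict k ≡ false → strict k′ ≡ false →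
      edgeDefect k k′ ≈ masses k k′
    edgeDefect-outside {k} {k′} k~k′ k∉ k′∉ = begin
      edgeDefect k k′
        ≈⟨ +-cong (if-false P≡false) (-‿cong (+-cong (if-false k∉) (-‿cong (if-false k′∉)))) ⟩
      0# - (0# - 0#)
        ≈⟨ trans (+-congˡ (-‿cong (-‿inverseʳ 0#))) (-‿inverseʳ 0#) ⟩
      0#
        ≈⟨ +-identityʳ 0# ⟨
      0# + 0#
        ≈⟨ +-cong (pointMass-off i l _ k k′ (inj₂ (≢l k′∉))) (pointMass-off l i _ k k′ (inj₁ (≢l k∉))) ⟨
      masses k k′ ∎
      where
      P≡false : P k k′ ≡ false
      P≡false with strictSubtree-false {i} {l} {k} k∉ | strictSubtree-false {i} {l} {k′} k′∉
      ... | inj₂ k∉T    | _           = ≡.cong (_∧ inSubtree i l k′) k∉T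
      ... | inj₁ ≡.refl | inj₂ k′∉T   = ≡.trans (≡.cong (inSubtree i l i ∧_) k′∉T) (Bool.∧-zeroʳ _)
      ... | inj₁ ≡.refl | inj₁ ≡.refl = ⊥-elim (adj-irrefl k~k′)

    edgeDefect-rootward : towards l i j ≡ true → edgeDefect l i ≈ masses l i
    edgeDefect-rootward h = begin
      edgeDefect l i
        ≈⟨ +-cong (if-true (≡.cong₂ _∧_ (∈T {l} l∈) (inSubtree-root i l)))
                  (-‿cong (+-cong (if-true l∈) (-‿cong (if-false (strictSubtree-root i l))))) ⟩
      edgeWeight l i - ((1# - τinTerm l i) * D l j - 0#)
        ≈⟨ +-congˡ (-‿cong (trans (+-congˡ ε⁻¹≈ε) (+-identityʳ _))) ⟩
      edgeWeight l i - (1# - τinTerm l i) * D l j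
        ≈⟨ if-true h ⟨
      towardsRoot
        ≈⟨ trans (+-cong (pointMass-off i l _ l i (inj₁ l≢i)) (pointMass-at l i towardsRoot)) (+-identityˡ _) ⟨
      masses l i ∎
      where l∈ = strictSubtree-neighbour i~l

    edgeDefect-leafward : towards i l j ≡ true → edgeDefect i l ≈ masses i l
    edgeDefect-leafward h = begin
      edgeDefect i l
        ≈⟨ +-cong (if-true (≡.cong₂ _∧_ (inSubtree-root i l) (∈T {l} l∈)))
                  (-‿cong (+-cong (if-false (strictSubtree-root i l)) (-‿cong (if-true l∈)))) ⟩
      edgeWeight i l - (0# - τinTerm l i * D l j)
        ≈⟨ solve 2 (λ e c → e :- (:0 :- c) := e :+ c) refl _ _ ⟩
      edgeWeight i l + τinTerm l i * D l j
        ≈⟨ if-true h ⟨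
      towardsLeaf
        ≈⟨ trans (+-cong (pointMass-at i l towardsLeaf) (pointMass-off l i _ i l (inj₁ (l≢i ∘ ≡.sym)))) (+-identityʳ _) ⟨
      masses i l ∎
      where l∈ = strictSubtree-neighbour i~l

    -- Edges inside T_{i→l} ∖ {i} cancel by D-edge and edges outside it do not contribute,
    -- so only the edge between i and l survives.
    edgeDefect≈masses : ∀ {k k′} → towards k k′ j ≡ true → edgeDefect k k′ ≈ masses k k′
    edgeDefect≈masses {k} {k′} h = byMembership (strict k) ≡.refl (strict k′) ≡.refl
      where
      k~k′ = towards⇒adj h
      byMembership : ∀ b → strict k ≡ b → ∀ b′ → strict k′ ≡ b′ → edgeDefect k k′ ≈ masses k k′
      byMembership true  k∈ true  k′∈ = edgeDefect-inside h k∈ k′∈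
      byMembership false k∉ false k′∉ = edgeDefect-outside k~k′ k∉ k′∉
      byMembership true  k∈ false k′∉
        with inSubtree-step i~l k~k′ (≢i k∈) (∈T k∈)
      ... | inj₁ (≡.refl , ≡.refl) = edgeDefect-rootward h
      ... | inj₂ (k′≢i , k′∈T) with () ← ≡.trans (≡.sym k′∉) (strictSubtree-intro k′≢i k′∈T)
      byMembership false k∉ true  k′∈
        with inSubtree-step i~l (adj-sym k~k′) (≢i k′∈) (∈T k′∈)
      ... | inj₁ (≡.refl , ≡.refl) = edgeDefect-leafward h
      ... | inj₂ (k≢i , k∈T) with () ← ≡.trans (≡.sym k∉) (strictSubtree-intro k≢i k∈T)

    subtreeDefect-neighbour : subtreeDefect i j l ≈ towardsLeaf + towardsRoot
    subtreeDefect-neighbour = begin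
      edgeSum P - sum (λ k → if strict k then τin k * D k j else 0#)
        ≈⟨ +-cong (edgeSum-byOrientedEdge j P P-sym) (-‿cong (τin-byOrientedEdge j strict (λ v → D v j))) ⟩
      sum₂ edges - (atRoot + sum₂ fluxes)
        ≈⟨ +-congˡ (-‿cong (trans (+-congʳ atRoot≈0) (+-identityˡ _))) ⟩
      sum₂ edges - sum₂ fluxes
        ≈⟨ sum₂-distrib-- edges fluxes ⟨
      sum₂ (λ k k′ → edges k k′ - fluxes k k′)
        ≈⟨ sum₂-cong pointwise ⟩
      sum₂ masses
        ≈⟨ sum₂-distrib-+ (pointMass i l towardsLeaf) (pointMass l i towardsRoot) ⟩
      sum₂ (pointMass i l towardsLeaf) + sum₂ (pointMass l i towardsRoot)
        ≈⟨ +-cong (sum₂-pointMass i l towardsLeaf) (sum₂-pointMass l i towardsRoot) ⟩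
      towardsLeaf + towardsRoot ∎
      where
      P-sym : ∀ u w → P u w ≡ P w u
      P-sym u w = Bool.∧-comm (inSubtree i l u) (inSubtree i l w)
      edges fluxes : Fin n → Fin n → Carrier
      edges  k k′ = if towards k k′ j then (if P k k′ then edgeWeight k k′ else 0#) else 0#
      fluxes k k′ = if towards k k′ j then flux strict (λ v → D v j) k k′ else 0#
      atRoot : Carrier
      atRoot = if strict j then D j j else 0#
      atRoot≈0 : atRoot ≈ 0#
      atRoot≈0 with strict j
      ... | true  = D-self j
      ... | false = refl
      pointwise : ∀ k k′ → edges k k′ - fluxes k k′ ≈ masses k k′
      pointwise k k′ with towards k k′ j in h
      ... | true  = edgeDefect≈masses h
      ... | false = begin
        0# - 0#      ≈⟨ -‿inverseʳ 0# ⟩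
        0#           ≈⟨ +-identityʳ 0# ⟨
        0# + 0#      ≈⟨ +-cong (pointMass-guarded towards′ _ h) (pointMass-guarded towards′ _ h) ⟨
        masses k k′  ∎
        where towards′ = λ u w → towards u w j

  -- The contributions of the neighbour l of i to τout i, (L D) i j and (C diag(τin) D) i j.
  τoutTerm : Fin n → Fin n → Carrier
  τoutTerm i l = when R (adj i l) (λ p → m i l * (m l i - 1#) * qinv i l p)

  LDTerm : Fin n → Fin n → Fin n → Carrier
  LDTerm i j l = when R (adj i l) (λ p → m l i * (ainv i l p * qinv i l p)) * D i j
               + when R (adj i l) (λ p → - (m i l * (ainv i l p * qinv i l p))) * D l j

  CτinDTerm : Fin n → Fin n → Fin n → Carrier
  CτinDTerm i j l = when R (adj i l) (λ p → ainv i l p * subtreeDefect i j l)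

  neighbourTerm : Fin n → Fin n → Fin n → Carrier
  neighbourTerm i j l = τoutTerm i l + LDTerm i j l - CτinDTerm i j l

  module _ {i l : Fin n} (p : Adj adj i l) (j : Fin n) where

    private
      A = ainv i l p
      x = m i l
      y = m l i
      q = qinv i l p
      aᵢₗ = a i l

      F : Carrier → Carrier → Carrier → Carrier
      F Dᵢ Dₗ E = x * (y - 1#) * q + ((y * (A * q)) * Dᵢ + (- (x * (A * q))) * Dₗ) - A * E

      F-cong : ∀ {Dᵢ Dᵢ′ Dₗ Dₗ′ E E′} → Dᵢ ≈ Dᵢ′ → Dₗ ≈ Dₗ′ → E ≈ E′ → F Dᵢ Dₗ E ≈ F Dᵢ′ Dₗ′ E′
      F-cong Dᵢ≈ Dₗ≈ E≈ = +-cong (+-congˡ (+-cong (*-congˡ Dᵢ≈) (*-congˡ Dₗ≈))) (-‿cong (*-congˡ E≈))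

      neighbourTerm≈F : neighbourTerm i j l ≈ F (D i j) (D l j) (towardsLeaf p j + towardsRoot p j)
      neighbourTerm≈F = begin
        τoutTerm i l + LDTerm i j l - CτinDTerm i j l
          ≈⟨ +-cong (+-cong (when-yes _ p) (+-cong (*-congʳ (when-yes _ p)) (*-congʳ (when-yes _ p)))) (-‿cong (when-yes _ p)) ⟩
        F (D i j) (D l j) (subtreeDefect i j l)
          ≈⟨ F-cong refl refl (subtreeDefect-neighbour p j) ⟩
        F (D i j) (D l j) (towardsLeaf p j + towardsRoot p j) ∎

    neighbourTerm-leafward : towards i l j ≡ true → neighbourTerm i j l ≈ 1#
    neighbourTerm-leafward to = begin
      neighbourTerm i j l
        ≈⟨ neighbourTerm≈F ⟩
      F (D i j) (D l j) (towardsLeaf p j + towardsRoot p j)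
        ≈⟨ F-cong (D-step (proj₂ (towards⇒step to))) refl
                  (trans (+-cong (if-true to) (if-false (towards-antisym to)))
                         (trans (+-identityʳ _) (+-cong (edgeWeight-adj i l p) (*-congʳ (τinTerm-adj′ i l p))))) ⟩
      F (aᵢₗ * (x - 1#) + x * D l j) (D l j) (aᵢₗ * (x - 1#) * (y - 1#) * q + x * (y - 1#) * q * D l j)
        ≈⟨ solve 6 (λ A aᵢₗ x y q Dₗ →
               x :* (y :- :1) :* q :+ ((y :* (A :* q)) :* (aᵢₗ :* (x :- :1) :+ x :* Dₗ) :+ (:- (x :* (A :* q))) :* Dₗ)
                 :- A :* (aᵢₗ :* (x :- :1) :* (y :- :1) :* q :+ x :* (y :- :1) :* q :* Dₗ)
             := :1 :+ (q :* (x :- :1)) :* (aᵢₗ :* A :- :1) :+ :1 :* ((x :* y :- :1) :* q :- :1))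
             refl A aᵢₗ x y q (D l j) ⟩
      1# + (q * (x - 1#)) * (aᵢₗ * A - 1#) + 1# * ((x * y - 1#) * q - 1#)
        ≈⟨ +-cong (+-congˡ (*-[u-1]≈0 _ (a-inverse i l p))) (*-[u-1]≈0 _ (q-inverse i l p)) ⟩
      1# + 0# + 0#
        ≈⟨ trans (+-identityʳ _) (+-identityʳ _) ⟩
      1# ∎

    neighbourTerm-rootward : towards l i j ≡ true → neighbourTerm i j l ≈ 0#
    neighbourTerm-rootward from = begin
      neighbourTerm i j l
        ≈⟨ neighbourTerm≈F ⟩
      F (D i j) (D l j) (towardsLeaf p j + towardsRoot p j)
        ≈⟨ F-cong refl Dₗ≈ (trans (+-cong (if-false (towards-antisym from)) (if-true from))
                                   (trans (+-identityˡ _) (+-cong edge≈ (-‿cong (*-cong (+-congˡ (-‿cong (τinTerm-adj′ i l p))) Dₗ≈))))) ⟩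
      F (D i j) (aᵢₗ * (y - 1#) + y * D i j) (aᵢₗ * (y - 1#) * (x - 1#) * q - (1# - x * (y - 1#) * q) * (aᵢₗ * (y - 1#) + y * D i j))
        ≈⟨ solve 6 (λ A aᵢₗ x y q Dᵢ →
               x :* (y :- :1) :* q :+ ((y :* (A :* q)) :* Dᵢ :+ (:- (x :* (A :* q))) :* (aᵢₗ :* (y :- :1) :+ y :* Dᵢ))
                 :- A :* (aᵢₗ :* (y :- :1) :* (x :- :1) :* q :- (:1 :- x :* (y :- :1) :* q) :* (aᵢₗ :* (y :- :1) :+ y :* Dᵢ))
             := (:- :1 :- q :+ y :+ y :* q :+ x :* q :- x :* y :* y :* q) :* (aᵢₗ :* A :- :1)
                  :+ (:1 :- y :- A :* y :* Dᵢ) :* ((x :* y :- :1) :* q :- :1))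
             refl A aᵢₗ x y q (D i j) ⟩
      _ * (aᵢₗ * A - 1#) + _ * ((x * y - 1#) * q - 1#)
        ≈⟨ +-cong (*-[u-1]≈0 _ (a-inverse i l p)) (*-[u-1]≈0 _ (q-inverse i l p)) ⟩
      0# + 0#
        ≈⟨ +-identityʳ 0# ⟩
      0# ∎
      where
      Dₗ≈ : D l j ≈ aᵢₗ * (y - 1#) + y * D i j
      Dₗ≈ = trans (D-step (proj₂ (towards⇒step from))) (+-congʳ (*-congʳ (sym (a-sym i l p))))
      edge≈ : edgeWeight l i ≈ aᵢₗ * (y - 1#) * (x - 1#) * q
      edge≈ = trans (edgeWeight-adj l i (adj-sym p)) (*-cong (*-congʳ (*-congʳ (sym (a-sym i l p)))) (sym (qinv-sym i l p (adj-sym p))))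

  neighbourTerm≈towards : ∀ i j l → neighbourTerm i j l ≈ (if towards i l j then 1# else 0#)
  neighbourTerm≈towards i j l with Bool.T? (adj i l)
  ... | no ¬i~l = begin
    τoutTerm i l + LDTerm i j l - CτinDTerm i j l
      ≈⟨ +-cong (+-cong (when-no _ ¬i~l) (+-cong (*-congʳ (when-no _ ¬i~l)) (*-congʳ (when-no _ ¬i~l)))) (-‿cong (when-no _ ¬i~l)) ⟩
    0# + (0# * D i j + 0# * D l j) - 0#
      ≈⟨ solve 2 (λ u v → :0 :+ (:0 :* u :+ :0 :* v) :- :0 := :0) refl (D i j) (D l j) ⟩
    0#
      ≈⟨ if-false (¬adj⇒¬towards j ¬i~l) ⟨
    (if towards i l j then 1# else 0#) ∎
  ... | yes p with towards-orientation j p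
  ...   | inj₁ (to , _)     = trans (neighbourTerm-leafward p j to) (sym (if-true to))
  ...   | inj₂ (¬to , from) = trans (neighbourTerm-rootward p j from) (sym (if-false ¬to))

  idM≈1-towards : ∀ i j → idM R i j ≈ 1# - sum (λ l → if towards i l j then 1# else 0#)
  idM≈1-towards i j with i Fin.≟ j
  ... | yes ≡.refl = sym (trans (+-congˡ (trans (-‿cong (sum-towards-target i 1#)) ε⁻¹≈ε)) (+-identityʳ 1#))
  ... | no i≢j     = sym (trans (+-congˡ (-‿cong (sum-towards i≢j 1#))) (-‿inverseʳ 1#))

  LD-byNeighbour : ∀ i j → sum (λ k → L i k * D k j) ≈ sum (LDTerm i j)
  LD-byNeighbour i j = begin
    sum (λ k → L i k * D k j)                                 ≈⟨ sum-cong-≋ split ⟩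
    sum (λ k → (if ⌊ i Fin.≟ k ⌋ then diag * D i j else 0#) + off k)
      ≈⟨ ∑-distrib-+ (λ k → if ⌊ i Fin.≟ k ⌋ then diag * D i j else 0#) off ⟩
    sum (λ k → if ⌊ i Fin.≟ k ⌋ then diag * D i j else 0#) + sum off
      ≈⟨ +-congʳ (sum-concentrated _ i (λ k k≢i → reflexive (if-no (i Fin.≟ k) (k≢i ∘ ≡.sym)))) ⟩
    (if ⌊ i Fin.≟ i ⌋ then diag * D i j else 0#) + sum off
      ≈⟨ +-congʳ (trans (reflexive (if-yes (i Fin.≟ i) ≡.refl)) (*-distribʳ-sum (D i j) diagTerm)) ⟩
    sum (λ l → diagTerm l * D i j) + sum off
      ≈⟨ ∑-distrib-+ (λ l → diagTerm l * D i j) off ⟨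
    sum (LDTerm i j) ∎
    where
    diagTerm off : Fin n → Carrier
    diagTerm l = when R (adj i l) (λ p → m l i * (ainv i l p * qinv i l p))
    off k = when R (adj i k) (λ p → - (m i k * (ainv i k p * qinv i k p))) * D k j
    diag : Carrier
    diag = sum diagTerm
    split : ∀ k → L i k * D k j ≈ (if ⌊ i Fin.≟ k ⌋ then diag * D i j else 0#) + off k
    split k with i Fin.≟ k
    ... | yes ≡.refl = sym (trans (+-congˡ (trans (*-congʳ (when-no _ adj-irrefl)) (zeroˡ _))) (+-identityʳ _))
    ... | no _       = sym (+-identityˡ _)

  module _ (αinv : Carrier) (α·αinv≈1 : α * αinv ≈ 1#) where
    open WithAlphaInv αinv

    branchIndicator : Fin n → Fin n → Fin n → Carrier
    branchIndicator i l k = when R (adj i l) (λ p → if strictSubtree i l k then ainv i l p else 0#)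

    branchWeight : Fin n → Fin n → Carrier
    branchWeight i k = sum (λ l → branchIndicator i l k)

    C≈β-branchWeight : ∀ i k → C i k ≈ β i - branchWeight i k
    C≈β-branchWeight i k with i Fin.≟ k
    ... | yes ≡.refl = sym (trans (+-congˡ (trans (-‿cong (sum-0 atRoot)) ε⁻¹≈ε)) (+-identityʳ _))
      where
      atRoot : ∀ l → branchIndicator i l i ≈ 0#
      atRoot l = trans (when-if (adj i l) (strictSubtree i l i) (ainv i l)) (if-false (strictSubtree-root i l))
    ... | no i≢k = +-congˡ (-‿cong (sum-cong-≋ (λ l → when-cong (adj i l) (λ p →
                     reflexive (≡.cong (if_then ainv i l p else 0#) (≡.sym (strictSubtree-≢ (i≢k ∘ ≡.sym))))))))

    CτinD-byNeighbour : ∀ i j → sum (λ k → C i k * τin k * D k j) ≈ sum (CτinDTerm i j)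
    CτinD-byNeighbour i j = begin
      sum (λ k → C i k * τin k * D k j)
        ≈⟨ sum-cong-≋ (λ k → trans (*-assoc _ _ _) (*-congʳ (C≈β-branchWeight i k))) ⟩
      sum (λ k → (β i - branchWeight i k) * W k)
        ≈⟨ sum-cong-≋ (λ k → [y-z]x≈yx-zx (W k) (β i) (branchWeight i k)) ⟩
      sum (λ k → β i * W k - branchWeight i k * W k)
        ≈⟨ ∑-distrib-- (λ k → β i * W k) (λ k → branchWeight i k * W k) ⟩
      sum (λ k → β i * W k) - sum (λ k → branchWeight i k * W k)
        ≈⟨ +-cong (trans (sym (*-distribˡ-sum (β i) W)) (trans (*-congˡ (τinᵀD≈α j)) β·α)) (-‿cong branched) ⟩
      sum edgesTerm - sum verticesTerm
        ≈⟨ ∑-distrib-- edgesTerm verticesTerm ⟨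
      sum (λ l → edgesTerm l - verticesTerm l)
        ≈⟨ sum-cong-≋ (λ l → trans (when-- (adj i l) _ _)
                                    (when-cong (adj i l) (λ p → sym (x[y-z]≈xy-xz _ _ _)))) ⟩
      sum (CτinDTerm i j) ∎
      where
      W : Fin n → Carrier
      W k = τin k * D k j
      subtreeEdges subtreeSum edgesTerm verticesTerm : Fin n → Carrier
      subtreeEdges l = edgeSum (λ u w → inSubtree i l u ∧ inSubtree i l w)
      subtreeSum l = sum (λ k → if strictSubtree i l k then W k else 0#)
      edgesTerm l = when R (adj i l) (λ p → ainv i l p * subtreeEdges l)
      verticesTerm l = when R (adj i l) (λ p → ainv i l p * subtreeSum l)
      β·α : β i * α ≈ sum edgesTerm
      β·α = trans (solve 3 (λ u b v → (u :* b) :* v := b :* (v :* u)) refl αinv (sum edgesTerm) α)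
                  (trans (*-congˡ α·αinv≈1) (*-identityʳ _))
      pull : ∀ b {A x} → (if b then A else 0#) * x ≈ A * (if b then x else 0#)
      pull true  = refl
      pull false = trans (zeroˡ _) (sym (zeroʳ _))
      branchTerm : ∀ l → Fin n → T (adj i l) → Carrier
      branchTerm l k p = (if strictSubtree i l k then ainv i l p else 0#) * W k
      branched : sum (λ k → branchWeight i k * W k) ≈ sum verticesTerm
      branched = begin
        sum (λ k → branchWeight i k * W k)
          ≈⟨ sum-cong-≋ (λ k → trans (*-distribʳ-sum (W k) (λ l → branchIndicator i l k))
                                     (sum-cong-≋ (λ l → when-*ʳ (adj i l) _ (W k)))) ⟩
        sum₂ (λ k l → when R (adj i l) (branchTerm l k))
          ≈⟨ ∑-comm (λ k l → when R (adj i l) (branchTerm l k)) ⟩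
        sum₂ (λ l k → when R (adj i l) (branchTerm l k))
          ≈⟨ sum-cong-≋ (λ l → trans (sum-when (adj i l) (branchTerm l)) (when-cong (adj i l) (λ p →
               trans (sum-cong-≋ (λ k → pull (strictSubtree i l k)))
                     (sym (*-distribˡ-sum (ainv i l p) (λ k → if strictSubtree i l k then W k else 0#)))))) ⟩
        sum verticesTerm ∎

    Dinv-leftInverse : Dinv *ᴹ D ≋ 1ᴹ
    Dinv-leftInverse i j = begin
      sum (λ k → Dinv i k * D k j)
        ≈⟨ sum-cong-≋ expand ⟩
      sum (λ k → rank₁ k - LD k + CτinD k)
        ≈⟨ trans (∑-distrib-+ (λ k → rank₁ k - LD k) CτinD) (+-congʳ (∑-distrib-- rank₁ LD)) ⟩
      (sum rank₁ - sum LD) + sum CτinD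
        ≈⟨ +-cong (+-cong rank₁≈τout (-‿cong (LD-byNeighbour i j))) (CτinD-byNeighbour i j) ⟩
      (1# - sum (τoutTerm i)) - sum (LDTerm i j) + sum (CτinDTerm i j)
        ≈⟨ solve 4 (λ o T L C → (o :- T) :- L :+ C := o :- (T :+ L :- C)) refl 1# _ _ _ ⟩
      1# - (sum (τoutTerm i) + sum (LDTerm i j) - sum (CτinDTerm i j))
        ≈⟨ +-congˡ (-‿cong (trans (∑-distrib-- (λ l → τoutTerm i l + LDTerm i j l) (CτinDTerm i j))
                                  (+-congʳ (∑-distrib-+ (τoutTerm i) (LDTerm i j))))) ⟨
      1# - sum (neighbourTerm i j)
        ≈⟨ +-congˡ (-‿cong (sum-cong-≋ (neighbourTerm≈towards i j))) ⟩
      1# - sum (λ l → if towards i l j then 1# else 0#)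
        ≈⟨ idM≈1-towards i j ⟨
      1ᴹ i j ∎
      where
      rank₁ LD CτinD : Fin n → Carrier
      rank₁ k = (αinv * τout i) * (τin k * D k j)
      LD k = L i k * D k j
      CτinD k = C i k * τin k * D k j
      expand : ∀ k → Dinv i k * D k j ≈ rank₁ k - LD k + CτinD k
      expand k = solve 6 (λ u o s l c d → (u :* (o :* s) :- l :+ c :* s) :* d := (u :* o) :* (s :* d) :- l :* d :+ c :* s :* d)
                         refl αinv (τout i) (τin k) (L i k) (C i k) (D k j)
      rank₁≈τout : sum rank₁ ≈ τout i
      rank₁≈τout = begin
        sum rank₁                                   ≈⟨ *-distribˡ-sum (αinv * τout i) (λ k → τin k * D k j) ⟨
        (αinv * τout i) * sum (λ k → τin k * D k j)  ≈⟨ *-congˡ (τinᵀD≈α j) ⟩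
        (αinv * τout i) * α                         ≈⟨ solve 3 (λ u o v → (u :* o) :* v := o :* (v :* u)) refl _ _ _ ⟩
        τout i * (α * αinv)                         ≈⟨ trans (*-congˡ α·αinv≈1) (*-identityʳ _) ⟩
        τout i                                      ∎

  α-invertible : Invertible R (det R D) → Invertible R α
  α-invertible det-invertible with det-invertible⇒rightInverse D det-invertible
  ... | E , D·E≋1 = sum (E ⊳ ζ r) , (begin
    α * sum (E ⊳ ζ r)                 ≈⟨ *-distribˡ-sum α (E ⊳ ζ r) ⟩
    sum (λ l → α * (E ⊳ ζ r) l)        ≈⟨ sum-cong-≋ (λ l → *-congʳ (τinᵀD≈α l)) ⟨
    (τin ⊲ D) · (E ⊳ ζ r)              ≈⟨ ·-⊳ τin D (E ⊳ ζ r) ⟨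
    τin · (D ⊳ E ⊳ ζ r)                ≈⟨ ·-congʳ τin (λ k → *ᴹ-⊳ D E (ζ r) k) ⟨
    τin · ((D *ᴹ E) ⊳ ζ r)             ≈⟨ ·-congʳ τin (λ k → trans (⊳-congˡ D·E≋1 k) (1ᴹ-⊳ (ζ r) k)) ⟩
    τin · ζ r                          ≈⟨ τinᵀζ≈1 r ⟩
    1#                                 ∎)
    where
    r : Fin n
    r = Fin.fromℕ< (IsTree.nonempty t)

theoremB : ∀ {c ℓ} (R : CommutativeRing c ℓ) → let open CommutativeRing R in
  (n : ℕ) (adj : Fin n → Fin n → Bool) (t : IsTree adj)
  (a m : Matrix R n) →
  (∀ i j → Adj adj i j → a i j ≈ a j i) →
  (aInv : ∀ i j → Adj adj i j → Invertible R (a i j)) →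
  (qInv : ∀ i j → Adj adj i j → Invertible R (m i j * m j i - 1#)) →
  Invertible R (det R (TreeObjects.D R adj t a m aInv qInv)) →
  Σ (Invertible R (TreeObjects.α R adj t a m aInv qInv)) (λ h →
    (∀ i j → _*M_ R (TreeObjects.D R adj t a m aInv qInv)
                    (TreeObjects.WithAlphaInv.Dinv R adj t a m aInv qInv (proj₁ h)) i j
             ≈ idM R i j)
    × (∀ i j → _*M_ R (TreeObjects.WithAlphaInv.Dinv R adj t a m aInv qInv (proj₁ h))
                      (TreeObjects.D R adj t a m aInv qInv) i j
             ≈ idM R i j))
theoremB R n adj t a m a-sym aInv qInv det-invertible = α-inv , D·Dinv≋1 , Dinv·D≋1
  where
  open TreeObjects R adj t a m aInv qInv using (α; D; module WithAlphaInv)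
  open InverseFormula R adj t a m a-sym aInv qInv
  open Matrices R using (_*ᴹ_; 1ᴹ; _≋_; leftInverse⇒rightInverse)
  open Determinant R using (det-invertible⇒rightInverse)
  α-inv : Invertible R α
  α-inv = α-invertible det-invertible
  Dinv·D≋1 : WithAlphaInv.Dinv (proj₁ α-inv) *ᴹ D ≋ 1ᴹ
  Dinv·D≋1 = Dinv-leftInverse (proj₁ α-inv) (proj₂ α-inv)
  D·Dinv≋1 : D *ᴹ WithAlphaInv.Dinv (proj₁ α-inv) ≋ 1ᴹ
  D·Dinv≋1 = leftInverse⇒rightInverse Dinv·D≋1 (proj₂ (det-invertible⇒rightInverse D det-invertible))
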